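{- The Lie algebra of primitive elements of $\mathbf{PBT}^*$ is spanned by the elements $\mathbf{V}_T$ where $T$ runs over the nonempty binary trees whose root has no right child. The Lie algebra of primitive elements of $\mathbf{PBT}^*$ is also spanned by the elements $\mathbf{W}_T$ where $T$ runs over the nonempty binary trees whose root has no left child.
   Context: For a word $w$, $\mathrm{std}(w)$ is obtained by scanning $w$ left to right and labelling $1,2,\dots$ the occurrences of its smallest letter, then the next smallest, etc. For $\sigma\in S_n$, $\mathbf{F}_\sigma=\sum_{\mathrm{std}(w)=\sigma^{ -1}}w$ in $\mathbb{K}\langle A\rangle$ ($A=\{1<2<\cdots\}$, $\mathbb{K}$ of characteristic $0$); $\mathbf{FQSym}$ is the Hopf algebra they span, with product given by the shifted shuffle and coproduct $\Delta\mathbf{F}_\sigma=\sum_{u\cdot v=\sigma}\mathbf{F}_{\mathrm{std}(u)}\otimes\mathbf{F}_{\mathrm{std}(v)}$. A binary tree is empty or a node with left and right subtrees. $\mathrm{bst}(w)$ is obtained by reading $w$ right to left and inserting each letter $x$: into an empty tree create a node labeled $x$; otherwise insert recursively into the left subtree if $x\le$ root label, into the right subtree if $x>$ root label. For an unlabeled tree $T$ with $n$ nodes, $w_T\in S_n$ is the right-to-left postfix reading (right subtree, left subtree, root, recursively) of the unique labeling of $T$ by $1,\dots,n$ with each label greater than those of its left subtree and smaller than those of its right subtree. $\mathbf{P}_T=\sum_{\mathrm{shape}(\mathrm{bst}(\sigma))=T}\mathbf{F}_\sigma$; $\mathbf{PBT}$ is the Hopf subalgebra of $\mathbf{FQSym}$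 with basis $(\mathbf{P}_T)$ and $\mathbf{PBT}^*$ its graded dual Hopf algebra. The weak order on $S_n$ is the reflexive transitive closure of $\sigma<\sigma s_i$ whenever exchanging the letters in positions $i,i+1$ of $\sigma$ increases the number of inversions. Define $\mathbf{H}_T=\sum_{T':\ w_{T'}\le w_T}\mathbf{P}_{T'}$ and $\mathbf{E}_T=\sum_{T':\ w_{T'}\ge w_T}\mathbf{P}_{T'}$ (weak order); these are bases of $\mathbf{PBT}$. $(\mathbf{V}_T)$ and $(\mathbf{W}_T)$ denote the bases of $\mathbf{PBT}^*$ dual to $(\mathbf{H}_T)$ and $(\mathbf{E}_T)$ respectively. An element $x$ is primitive if $\Delta x=x\otimes1+1\otimes x$. -}

module Defs where

open import Level using (Level; _⊔_)
open import Data.Nat using (ℕ; zero; suc; _+_; _*_; _≤ᵇ_)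
open import Data.Nat.Base using () renaming (_≡ᵇ_ to _==ℕ_)
open import Data.Bool using (Bool; true; false; if_then_else_; _∧_; _∨_)
open import Data.List using (List; []; _∷_; map; concatMap; filterᵇ; length; foldr; _++_)
open import Data.Bool.ListAction using (any)
open import Data.Product using (Σ; ∃; _×_; _,_; proj₁; proj₂)
open import Data.List.Relation.Unary.All using (All)
open import Relation.Binary.PropositionalEquality using (_≡_)
open import Relation.Nullary using (¬_)
open import Algebra.Bundles using (CommutativeRing)

-- Words, permutations (one-line notation, letters 1..n)

eqListℕ : List ℕ → List ℕ → Bool
eqListℕ []       []       = true
eqListℕ (x ∷ xs) (y ∷ ys) = (x ==ℕ y) ∧ eqListℕ xs ys
eqListℕ _        _        = false

insertAll : ℕ → List ℕ → List (List ℕ)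
insertAll a []       = (a ∷ []) ∷ []
insertAll a (x ∷ xs) = (a ∷ x ∷ xs) ∷ map (x ∷_) (insertAll a xs)

perms : ℕ → List (List ℕ)
perms zero    = [] ∷ []
perms (suc n) = concatMap (insertAll (suc n)) (perms n)

shuffle : List ℕ → List ℕ → List (List ℕ)
shuffle []       ys       = ys ∷ []
shuffle (x ∷ xs) []       = (x ∷ xs) ∷ []
shuffle (x ∷ xs) (y ∷ ys) =
  map (x ∷_) (shuffle xs (y ∷ ys)) ++ map (y ∷_) (shuffle (x ∷ xs) ys)

shift : ℕ → List ℕ → List ℕ
shift k = map (k +_)

-- Right weak order on permutations: reflexive-transitive closure of
-- σ < σ s_i when σ(i) < σ(i+1).  Every such step raises the number of
-- inversions by exactly one, so chains have length < n*n; the closure is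
-- computed with that much fuel.

upSteps : List ℕ → List (List ℕ)
upSteps []           = []
upSteps (x ∷ [])     = []
upSteps (x ∷ y ∷ xs) =
  (if suc x ≤ᵇ y then ((y ∷ x ∷ xs) ∷ []) else [])
  ++ map (x ∷_) (upSteps (y ∷ xs))

reach : ℕ → List ℕ → List ℕ → Bool
reach zero    σ τ = eqListℕ σ τ
reach (suc f) σ τ = eqListℕ σ τ ∨ any (λ ρ → reach f ρ τ) (upSteps σ)

weakLeq : List ℕ → List ℕ → Bool
weakLeq σ τ = reach (length σ * length σ) σ τ

data Tree : Set where
  leaf : Tree
  node : Tree → Tree → Tree

size : Tree → ℕ
size leaf       = 0
size (node l r) = suc (size l + size r)

eqTree : Tree → Tree → Bool
eqTree leaf         leaf         = true
eqTree (node l r)   (node l' r') = eqTree l l' ∧ eqTree r r'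
eqTree _            _            = false

data LTree : Set where
  lleaf : LTree
  lnode : LTree → ℕ → LTree → LTree

shape : LTree → Tree
shape lleaf         = leaf
shape (lnode l _ r) = node (shape l) (shape r)

bstInsert : ℕ → LTree → LTree
bstInsert x lleaf         = lnode lleaf x lleaf
bstInsert x (lnode l y r) =
  if x ≤ᵇ y then lnode (bstInsert x l) y r else lnode l y (bstInsert x r)

bst : List ℕ → LTree
bst = foldr bstInsert lleaf

-- right-to-left postfix reading of the in-order labelling (labels offset+1..)
readW : ℕ → Tree → List ℕ
readW k leaf       = []
readW k (node l r) = readW (suc (k + size l)) r ++ readW k l ++ (suc (k + size l) ∷ [])

wT : Tree → List ℕ
wT = readW 0

-- permutations σ of size(T) with shape(bst σ) = T  (P_T = Σ F_σ over these)
cls : Tree → List (List ℕ)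
cls T = filterᵇ (λ σ → eqTree (shape (bst σ)) T) (perms (size T))

-- coefficient of P_T in P_T1 · P_T2 (product in FQSym = shifted shuffle),
-- read off as the coefficient of F_{w_T} (w_T lies in the class of T)
structConst : Tree → Tree → Tree → ℕ
structConst T1 T2 T =
  length (filterᵇ (eqListℕ (wT T))
    (concatMap (λ σ → concatMap (λ τ → shuffle σ (shift (size T1) τ)) (cls T2)) (cls T1)))

RootNoRight : Tree → Set
RootNoRight T = ∃ λ l → T ≡ node l leaf

RootNoLeft : Tree → Set
RootNoLeft T = ∃ λ r → T ≡ node leaf r

-- PBT* over a commutative ring R.  An element is a finite formal sum
-- Σ c_i Q_{T_i}, where (Q_T) is the basis dual to (P_T).

module OverRing {c ℓ : Level} (R : CommutativeRing c ℓ) where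
  open CommutativeRing R using (Carrier; _≈_; 0#; 1#) renaming (_+_ to _⊕_; _*_ to _⊗_)

  fromℕ : ℕ → Carrier
  fromℕ zero    = 0#
  fromℕ (suc n) = 1# ⊕ fromℕ n

  IsFieldChar0 : Set (c ⊔ ℓ)
  IsFieldChar0 =
    (∀ x → ¬ (x ≈ 0#) → ∃ λ y → x ⊗ y ≈ 1#) ×
    (∀ n → ¬ (fromℕ (suc n) ≈ 0#))

  Elem : Set c
  Elem = List (Carrier × Tree)

  δ : Tree → Tree → Carrier
  δ T T' = if eqTree T T' then 1# else 0#

  sumL : List Carrier → Carrier
  sumL = foldr _⊕_ 0#

  -- coefficient of Q_T in x  (= ⟨x , P_T⟩)
  coeff : Elem → Tree → Carrier
  coeff x T = sumL (map (λ p → proj₁ p ⊗ δ (proj₂ p) T) x)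

  -- coefficient of Q_T1 ⊗ Q_T2 in Δx; Δ is the transpose of the product of PBT
  Δcoeff : Elem → Tree → Tree → Carrier
  Δcoeff x T1 T2 = sumL (map (λ p → proj₁ p ⊗ fromℕ (structConst T1 T2 (proj₂ p))) x)

  -- Δx = x ⊗ 1 + 1 ⊗ x   (1 = Q_leaf)
  Primitive : Elem → Set ℓ
  Primitive x = ∀ T1 T2 →
    Δcoeff x T1 T2 ≈ (δ T2 leaf ⊗ coeff x T1) ⊕ (δ T1 leaf ⊗ coeff x T2)

  -- ⟨x , H_T'⟩ and ⟨x , E_T'⟩
  pairH : Elem → Tree → Carrier
  pairH x T' = sumL (map (λ p → if weakLeq (wT (proj₂ p)) (wT T') then proj₁ p else 0#) x)

  pairE : Elem → Tree → Carrier
  pairE x T' = sumL (map (λ p → if weakLeq (wT T') (wT (proj₂ p)) then proj₁ p else 0#) x)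

  IsDualToH : (Tree → Elem) → Set ℓ
  IsDualToH v = ∀ T T' → pairH (v T) T' ≈ δ T T'

  IsDualToE : (Tree → Elem) → Set ℓ
  IsDualToE v = ∀ T T' → pairE (v T) T' ≈ δ T T'

  InSpan : (Tree → Set) → (Tree → Elem) → Elem → Set (c ⊔ ℓ)
  InSpan S v x = Σ (List (Carrier × Tree)) λ L →
    All (λ p → S (proj₂ p)) L ×
    (∀ T → coeff x T ≈ sumL (map (λ p → proj₁ p ⊗ coeff (v (proj₂ p)) T) L))

{-# OPTIONS --safe #-}
-- The coproduct of PBT* is the transpose of the product of PBT, and H_A · H_B = H_(A / B), where
-- A / B grafts B on the rightmost leaf of A. As (H_T) is unitriangular with respect to (P_T), an
-- element x is primitive iff ⟨x , H_T⟩ vanishes for T empty and for all T = A / B with A, B nonempty.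
-- These are exactly the trees that are empty or whose root has a right child, so x is primitive iff
-- it is a combination of the V_T whose root has no right child. The W-version is the same argument
-- for E_A · E_B = E_(A \ B), where A \ B grafts A on the leftmost leaf of B.
module Submission where

open import Defs
open import Level using (Level)
open import Data.Nat
open import Data.Nat.Properties as ℕ
  using ( _≟_; _≤?_; ≡ᵇ⇒≡; module ≤-Reasoning; ≤-refl; ≤-reflexive; ≤-trans; ≤-pred; <-trans; <-irrefl; <-asym; <-cmp
        ; ≤-<-trans; <-≤-trans; <⇒≤; <⇒≢; <⇒≱; ≰⇒>; n≤1+n; n<1+n; m≤n⇒m≤1+n; suc-injective
        ; +-suc; +-cancelˡ-≡; +-cancelˡ-<; +-mono-≤; +-monoʳ-≤; +-monoʳ-<
        ; m≤m+n; m≤n+m; m<m+n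
        ; *-zeroʳ; *-distribˡ-+; *-distribʳ-+; *-monoʳ-≤
        ; 0∸n≡0; m+n∸m≡n; m+[n∸m]≡n; m∸n≡0⇒m≤n; m≤n⇒m∸n≡0; +-∸-assoc; +-∸-comm; ∸-+-assoc; ∸-monoʳ-<; ∸-monoˡ-≤
        ; ⊔-lub; m≤m⊔n; m≤n⊔m )
open import Data.Bool using (Bool; true; false; if_then_else_; _∧_; not; T?)
open import Data.Bool.Properties using (∧-zeroʳ; ∧-identityʳ)
open import Data.Bool.ListAction using (any)
open import Data.Empty using (⊥)
open import Data.List using (List; []; _∷_; map; concatMap; filter; filterᵇ; length; foldr; _++_)
open import Data.List.Properties
  using ( ++-assoc; ++-identityʳ; map-++; map-∘; map-injective; length-++; length-map; foldr-++
        ; filter-++; filter-all; filter-none )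
open import Data.List.Membership.Propositional using (_∈_; find)
open import Data.List.Membership.Propositional.Properties
  using (∈-++⁺ˡ; ∈-++⁺ʳ; ∈-++⁻; ∈-map⁺; ∈-map⁻; ∈-concatMap⁻; ∈-filter⁺; ∈-filter⁻)
open import Data.List.Relation.Unary.Any using (here; there)
open import Data.List.Relation.Unary.All as All using (All; []; _∷_)
open import Data.List.Relation.Unary.All.Properties using (++⁺)
open import Data.Product using (∃; _×_; _,_; proj₁; proj₂)
open import Data.Sum using (_⊎_; inj₁; inj₂)
open import Function using (_∘_)
open import Relation.Binary.Definitions using (DecidableEquality; tri<; tri≈; tri>)
open import Relation.Binary.PropositionalEquality
open import Relation.Binary.Construct.Closure.ReflexiveTransitive using (Star; ε; _◅_; _◅◅_; gmap)
open import Relation.Nullary using (¬_; Dec; yes; no; does; proof; _because_; contradiction)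
open import Relation.Nullary.Reflects using (Reflects; ofʸ; ofⁿ)
open import Relation.Nullary.Decidable using (dec-true; dec-false; ¬?)
open import Relation.Unary using (Decidable)
open import Data.Nat.Induction using (<-rec)
open import Algebra.Bundles using (CommutativeRing)
open import Algebra.Properties.CommutativeSemigroup ℕ.+-commutativeSemigroup using () renaming (x∙yz≈y∙xz to +-exchange)

does-true⇒ : ∀ {a} {A : Set a} (a? : Dec A) → does a? ≡ true → A
does-true⇒ (yes a) _ = a

does-false⇒ : ∀ {a} {A : Set a} (a? : Dec A) → does a? ≡ false → ¬ A
does-false⇒ (no ¬a) _ = ¬a

≤⇒≤ᵇ≡true : ∀ {m n} → m ≤ n → (m ≤ᵇ n) ≡ true
≤⇒≤ᵇ≡true = dec-true (_ ≤? _)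

>⇒≤ᵇ≡false : ∀ {m n} → n < m → (m ≤ᵇ n) ≡ false
>⇒≤ᵇ≡false n<m = dec-false (_ ≤? _) (<⇒≱ n<m)

≤ᵇ≡true⇒≤ : ∀ {m n} → (m ≤ᵇ n) ≡ true → m ≤ n
≤ᵇ≡true⇒≤ = does-true⇒ (_ ≤? _)

≤ᵇ≡false⇒> : ∀ {m n} → (m ≤ᵇ n) ≡ false → n < m
≤ᵇ≡false⇒> = ≰⇒> ∘ does-false⇒ (_ ≤? _)

≢⇒≡ᵇ≡false : ∀ {m n} → m ≢ n → (m ≡ᵇ n) ≡ false
≢⇒≡ᵇ≡false = dec-false (_ ≟ _)

≡⇒≡ᵇ≡true : ∀ {m n} → m ≡ n → (m ≡ᵇ n) ≡ true
≡⇒≡ᵇ≡true = dec-true (_ ≟ _)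

≡ᵇ-refl : ∀ m → (m ≡ᵇ m) ≡ true
≡ᵇ-refl m = ≡⇒≡ᵇ≡true {m} refl

≡ᵇ≡true⇒≡ : ∀ {m n} → (m ≡ᵇ n) ≡ true → m ≡ n
≡ᵇ≡true⇒≡ = does-true⇒ (_ ≟ _)

eqListℕ-reflects : ∀ xs ys → Reflects (xs ≡ ys) (eqListℕ xs ys)
eqListℕ-reflects []       []       = ofʸ refl
eqListℕ-reflects []       (_ ∷ _)  = ofⁿ λ ()
eqListℕ-reflects (_ ∷ _)  []       = ofⁿ λ ()
eqListℕ-reflects (x ∷ xs) (y ∷ ys) with x ≡ᵇ y | proof (x ≟ y)
... | false | ofⁿ x≢y = ofⁿ λ { refl → x≢y refl }
... | true  | ofʸ refl with eqListℕ xs ys | eqListℕ-reflects xs ys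
...   | false | ofⁿ xs≢ys = ofⁿ λ { refl → xs≢ys refl }
...   | true  | ofʸ refl  = ofʸ refl

_≟ᴸ_ : DecidableEquality (List ℕ)
xs ≟ᴸ ys = eqListℕ xs ys because eqListℕ-reflects xs ys

eqTree-reflects : ∀ S T → Reflects (S ≡ T) (eqTree S T)
eqTree-reflects leaf       leaf         = ofʸ refl
eqTree-reflects leaf       (node _ _)   = ofⁿ λ ()
eqTree-reflects (node _ _) leaf         = ofⁿ λ ()
eqTree-reflects (node l r) (node l' r') with eqTree l l' | eqTree-reflects l l'
... | false | ofⁿ l≢l' = ofⁿ λ { refl → l≢l' refl }
... | true  | ofʸ refl with eqTree r r' | eqTree-reflects r r'
...   | false | ofⁿ r≢r' = ofⁿ λ { refl → r≢r' refl }
...   | true  | ofʸ refl  = ofʸ refl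

_≟ᵀ_ : DecidableEquality Tree
S ≟ᵀ T = eqTree S T because eqTree-reflects S T

≡∧-intro : ∀ {b c d} → (b ≡ true → c ≡ true × d ≡ true) → (c ≡ true → d ≡ true → b ≡ true) → b ≡ (c ∧ d)
≡∧-intro {true}  ⇒ _ with ⇒ refl
... | refl , refl = refl
≡∧-intro {false} {true} {true} _ ⇐ = ⇐ refl refl
≡∧-intro {false} {true} {false} _ _ = refl
≡∧-intro {false} {false}        _ _ = refl

eqListℕ-refl : ∀ xs → eqListℕ xs xs ≡ true
eqListℕ-refl xs = dec-true (xs ≟ᴸ xs) refl

eqTree-refl : ∀ T → eqTree T T ≡ true
eqTree-refl T = dec-true (T ≟ᵀ T) refl

-- The right weak order

data Step : List ℕ → List ℕ → Set where
  swap : ∀ {x y xs} → x < y → Step (x ∷ y ∷ xs) (y ∷ x ∷ xs)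
  skip : ∀ {x σ σ'} → Step σ σ' → Step (x ∷ σ) (x ∷ σ')

Weak : List ℕ → List ℕ → Set
Weak = Star Step

Step⇒∈upSteps : ∀ {σ σ'} → Step σ σ' → σ' ∈ upSteps σ
Step⇒∈upSteps (swap x<y)             rewrite ≤⇒≤ᵇ≡true x<y = here refl
Step⇒∈upSteps (skip {x} {_ ∷ _} s) = ∈-++⁺ʳ _ (∈-map⁺ (x ∷_) (Step⇒∈upSteps s))

∈upSteps⇒Step : ∀ σ {σ'} → σ' ∈ upSteps σ → Step σ σ'
∈upSteps⇒Step (x ∷ y ∷ xs) σ'∈ with ∈-++⁻ (if suc x ≤ᵇ y then (y ∷ x ∷ xs) ∷ [] else []) σ'∈
... | inj₂ σ'∈skips with ∈-map⁻ (x ∷_) σ'∈skips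
...   | _ , ρ∈ , refl = skip (∈upSteps⇒Step (y ∷ xs) ρ∈)
∈upSteps⇒Step (x ∷ y ∷ xs) _ | inj₁ σ'∈swap with suc x ≤ᵇ y in x<y
∈upSteps⇒Step (x ∷ y ∷ xs) _ | inj₁ (here refl) | true = swap (≤ᵇ≡true⇒≤ x<y)

largerThan : ℕ → List ℕ → ℕ
largerThan x []       = 0
largerThan x (y ∷ ys) = if suc x ≤ᵇ y then suc (largerThan x ys) else largerThan x ys

coinversions : List ℕ → ℕ
coinversions []       = 0
coinversions (x ∷ xs) = largerThan x xs + coinversions xs

largerThan-Step : ∀ z {σ σ'} → Step σ σ' → largerThan z σ' ≡ largerThan z σ
largerThan-Step z (swap {x} {y} _) with suc z ≤ᵇ x | suc z ≤ᵇ y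
... | true  | true  = refl
... | true  | false = refl
... | false | true  = refl
... | false | false = refl
largerThan-Step z (skip {x} s) with suc z ≤ᵇ x
... | true  = cong suc (largerThan-Step z s)
... | false = largerThan-Step z s

coinversions-Step : ∀ {σ σ'} → Step σ σ' → suc (coinversions σ') ≡ coinversions σ
coinversions-Step (swap {x} {y} {xs} x<y)
  rewrite ≤⇒≤ᵇ≡true x<y | >⇒≤ᵇ≡false {suc y} {x} (s≤s (<⇒≤ x<y)) =
  cong suc (+-exchange (largerThan y xs) (largerThan x xs) (coinversions xs))
coinversions-Step (skip {x} {σ} {σ'} s) rewrite largerThan-Step x s =
  trans (sym (+-suc (largerThan x σ) (coinversions σ'))) (cong (largerThan x σ +_) (coinversions-Step s))

largerThan≤length : ∀ x xs → largerThan x xs ≤ length xs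
largerThan≤length x []       = z≤n
largerThan≤length x (y ∷ ys) with suc x ≤ᵇ y
... | true  = s≤s (largerThan≤length x ys)
... | false = m≤n⇒m≤1+n (largerThan≤length x ys)

coinversions≤length² : ∀ xs → coinversions xs ≤ length xs * length xs
coinversions≤length² []       = z≤n
coinversions≤length² (x ∷ xs) = begin
  largerThan x xs + coinversions xs     ≤⟨ +-mono-≤ (largerThan≤length x xs) (coinversions≤length² xs) ⟩
  length xs + length xs * length xs     ≤⟨ +-monoʳ-≤ (length xs) (*-monoʳ-≤ (length xs) (n≤1+n (length xs))) ⟩
  length xs + length xs * length (x ∷ xs) ≤⟨ n≤1+n _ ⟩
  length (x ∷ xs) * length (x ∷ xs)     ∎
  where open ≤-Reasoning

Weak-length : ∀ {σ τ} → Weak σ τ → length τ ≡ length σ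
Weak-length ε       = refl
Weak-length (s ◅ w) = trans (Weak-length w) (Step-length s)
  where
  Step-length : ∀ {σ σ'} → Step σ σ' → length σ' ≡ length σ
  Step-length (swap _) = refl
  Step-length (skip s) = cong suc (Step-length s)

Weak⇒≡⊎coinversions< : ∀ {σ τ} → Weak σ τ → σ ≡ τ ⊎ coinversions τ < coinversions σ
Weak⇒≡⊎coinversions< ε = inj₁ refl
Weak⇒≡⊎coinversions< (s ◅ w) with Weak⇒≡⊎coinversions< w
... | inj₁ refl = inj₂ (≤-reflexive (coinversions-Step s))
... | inj₂ lt   = inj₂ (<-trans lt (≤-reflexive (coinversions-Step s)))

any≡true⇒ : ∀ {A : Set} (p : A → Bool) xs → any p xs ≡ true → ∃ λ x → x ∈ xs × p x ≡ true
any≡true⇒ p (x ∷ xs) e with p x in px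
... | true  = x , here refl , px
... | false with any≡true⇒ p xs e
...   | y , y∈ , py = y , there y∈ , py

∈⇒any≡true : ∀ {A : Set} (p : A → Bool) {xs x} → x ∈ xs → p x ≡ true → any p xs ≡ true
∈⇒any≡true p (here refl) px rewrite px = refl
∈⇒any≡true p {y ∷ _} (there x∈) px rewrite ∈⇒any≡true p x∈ px with p y
... | true  = refl
... | false = refl

reach-sound : ∀ f σ τ → reach f σ τ ≡ true → Weak σ τ
reach-sound zero    σ τ e rewrite does-true⇒ (σ ≟ᴸ τ) e = ε
reach-sound (suc f) σ τ e with eqListℕ σ τ in σ≡τ
... | true rewrite does-true⇒ (σ ≟ᴸ τ) σ≡τ = ε
... | false with any≡true⇒ (λ ρ → reach f ρ τ) (upSteps σ) e
...   | ρ , ρ∈ , reached = ∈upSteps⇒Step σ ρ∈ ◅ reach-sound f ρ τ reached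

-- Every step lowers the number of coinversions, so fuel coinversions σ suffices.
reach-complete : ∀ f {σ τ} → Weak σ τ → coinversions σ ≤ f → reach f σ τ ≡ true
reach-complete zero    {σ} ε _ = eqListℕ-refl σ
reach-complete (suc f) {σ} ε _ rewrite eqListℕ-refl σ = refl
reach-complete zero    (s ◅ _) le with () ← ≤-trans (≤-reflexive (coinversions-Step s)) le
reach-complete (suc f) {σ} {τ} (s ◅ w) le with eqListℕ σ τ
... | true  = refl
... | false = ∈⇒any≡true (λ ρ → reach f ρ τ) (Step⇒∈upSteps s)
                (reach-complete f w (≤-pred (≤-trans (≤-reflexive (coinversions-Step s)) le)))

weakLeq-sound : ∀ σ τ → weakLeq σ τ ≡ true → Weak σ τ
weakLeq-sound σ τ = reach-sound (length σ * length σ) σ τ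

weakLeq-complete : ∀ {σ τ} → Weak σ τ → weakLeq σ τ ≡ true
weakLeq-complete {σ} w = reach-complete _ w (coinversions≤length² σ)

Weak-∷ : ∀ x {σ τ} → Weak σ τ → Weak (x ∷ σ) (x ∷ τ)
Weak-∷ x = gmap (x ∷_) skip

Weak-++ˡ : ∀ u {σ τ} → Weak σ τ → Weak (u ++ σ) (u ++ τ)
Weak-++ˡ u = gmap (u ++_) (Step-++ˡ u)
  where
  Step-++ˡ : ∀ u {σ σ'} → Step σ σ' → Step (u ++ σ) (u ++ σ')
  Step-++ˡ []      s = s
  Step-++ˡ (x ∷ u) s = skip (Step-++ˡ u s)

Weak-++ʳ : ∀ t {σ τ} → Weak σ τ → Weak (σ ++ t) (τ ++ t)
Weak-++ʳ t = gmap (_++ t) Step-++ʳ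
  where
  Step-++ʳ : ∀ {σ σ'} → Step σ σ' → Step (σ ++ t) (σ' ++ t)
  Step-++ʳ (swap x<y) = swap x<y
  Step-++ʳ (skip s)   = skip (Step-++ʳ s)

Weak-shift : ∀ k {σ τ} → Weak σ τ → Weak (map (k +_) σ) (map (k +_) τ)
Weak-shift k = gmap (map (k +_)) Step-shift
  where
  Step-shift : ∀ {σ σ'} → Step σ σ' → Step (map (k +_) σ) (map (k +_) σ')
  Step-shift (swap x<y) = swap (+-monoʳ-< k x<y)
  Step-shift (skip s)   = skip (Step-shift s)

Weak-unshift : ∀ k {σ τ} → Weak (map (k +_) σ) (map (k +_) τ) → Weak σ τ
Weak-unshift k w = go w refl refl
  where
  Step-unshift : ∀ σ {ρ} → Step (map (k +_) σ) ρ → ∃ λ σ' → ρ ≡ map (k +_) σ' × Step σ σ'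
  Step-unshift (x ∷ y ∷ xs) (swap x<y) = y ∷ x ∷ xs , refl , swap (+-cancelˡ-< k _ _ x<y)
  Step-unshift (x ∷ []) (skip ())
  Step-unshift (x ∷ y ∷ xs) (skip s) with Step-unshift (y ∷ xs) s
  ... | σ' , refl , s' = x ∷ σ' , refl , skip s'
  go : ∀ {ρ₁ ρ₂ σ τ} → Weak ρ₁ ρ₂ → ρ₁ ≡ map (k +_) σ → ρ₂ ≡ map (k +_) τ → Weak σ τ
  go ε        refl e = subst (Weak _) (map-injective (+-cancelˡ-≡ k _ _) e) ε
  go {σ = σ} (s ◅ w) refl e with Step-unshift σ s
  ... | σ' , refl , s' = s' ◅ go w refl e

Weak-moveRight : ∀ x u t → All (x <_) u → Weak (x ∷ u ++ t) (u ++ x ∷ t)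
Weak-moveRight x []      t []            = ε
Weak-moveRight x (y ∷ u) t (x<y ∷ x<u) = swap x<y ◅ Weak-∷ y (Weak-moveRight x u t x<u)

Weak-filter : ∀ {p} {P : ℕ → Set p} (P? : Decidable P) {σ τ} → Weak σ τ → Weak (filter P? σ) (filter P? τ)
Weak-filter P? ε       = ε
Weak-filter P? (s ◅ w) with Step-filter s
  where
  Step-filter : ∀ {σ σ'} → Step σ σ' → filter P? σ' ≡ filter P? σ ⊎ Step (filter P? σ) (filter P? σ')
  -- filter is defined by with, so its tests on x and y surface one at a time; hence the rewrites.
  Step-filter (swap {x} {y} x<y) with does (P? x) in px | does (P? y) in py
  ... | true  | true  rewrite px | py = inj₂ (swap x<y)
  ... | true  | false rewrite px | py = inj₁ refl
  ... | false | true  rewrite px | py = inj₁ refl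
  ... | false | false rewrite px | py = inj₁ refl
  Step-filter (skip {x} s) with does (P? x) | Step-filter s
  ... | true  | inj₁ e  = inj₁ (cong (x ∷_) e)
  ... | true  | inj₂ s' = inj₂ (skip s')
  ... | false | r       = r
... | inj₁ e  rewrite sym e = Weak-filter P? w
... | inj₂ s' = s' ◅ Weak-filter P? w

lettersUpTo lettersAbove : ℕ → List ℕ → List ℕ
lettersUpTo  k = filter (_≤? k)
lettersAbove k = filter (λ z → ¬? (z ≤? k))

Weak-raiseLettersAbove : ∀ k π → Weak π (lettersAbove k π ++ lettersUpTo k π)
Weak-raiseLettersAbove k []      = ε
Weak-raiseLettersAbove k (x ∷ π) with x ≤ᵇ k in x≤k
... | false = Weak-∷ x (Weak-raiseLettersAbove k π)
... | true  = Weak-∷ x (Weak-raiseLettersAbove k π) ◅◅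
  Weak-moveRight x (lettersAbove k π) (lettersUpTo k π)
    (All.tabulate λ z∈ → ≤-<-trans (≤ᵇ≡true⇒≤ x≤k) (≰⇒> (proj₂ (∈-filter⁻ (λ z → ¬? (z ≤? k)) {xs = π} z∈))))

-- Canonical words of binary trees

readW-lowerBound : ∀ j T → All (j <_) (readW j T)
readW-lowerBound j leaf       = []
readW-lowerBound j (node l r) =
  ++⁺ (All.map (<-trans (s≤s (m≤m+n j (size l)))) (readW-lowerBound (suc (j + size l)) r))
      (++⁺ (readW-lowerBound j l) (s≤s (m≤m+n j (size l)) ∷ []))

+-suc-assoc : ∀ j a b → suc (j + a) + b ≡ j + suc (a + b)
+-suc-assoc j a b = trans (cong suc (ℕ.+-assoc j a b)) (sym (+-suc j (a + b)))

readW-upperBound : ∀ j T → All (_≤ j + size T) (readW j T)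
readW-upperBound j leaf       = []
readW-upperBound j (node l r) =
  ++⁺ (All.map (λ q → ≤-trans q (≤-reflexive (+-suc-assoc j (size l) (size r)))) (readW-upperBound (suc (j + size l)) r))
      (++⁺ (All.map (λ q → ≤-trans q (+-monoʳ-≤ j (m≤n⇒m≤1+n (m≤m+n (size l) (size r))))) (readW-upperBound j l))
           (≤-trans (m≤m+n (suc (j + size l)) (size r)) (≤-reflexive (+-suc-assoc j (size l) (size r))) ∷ []))

length-readW : ∀ j T → length (readW j T) ≡ size T
length-readW j leaf       = refl
length-readW j (node l r)
  rewrite length-++ (readW (suc (j + size l)) r) {readW j l ++ suc (j + size l) ∷ []}
        | length-++ (readW j l) {suc (j + size l) ∷ []}
        | length-readW (suc (j + size l)) r | length-readW j l
        | ℕ.+-comm (size l) 1 | ℕ.+-comm (size l) (size r) = +-suc (size r) (size l)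

readW-+ : ∀ i j T → readW (i + j) T ≡ map (i +_) (readW j T)
readW-+ i j leaf       = refl
readW-+ i j (node l r)
  rewrite map-++ (i +_) (readW (suc (j + size l)) r) (readW j l ++ suc (j + size l) ∷ [])
        | map-++ (i +_) (readW j l) (suc (j + size l) ∷ [])
        | sym (readW-+ i (suc (j + size l)) r)
        | sym (readW-+ i j l)
        | +-suc-assoc i j (size l) = refl

readW≡shift-wT : ∀ k T → readW k T ≡ map (k +_) (wT T)
readW≡shift-wT k T = trans (cong (λ m → readW m T) (sym (ℕ.+-identityʳ k))) (readW-+ k 0 T)

graftR : Tree → Tree → Tree
graftR leaf       B = B
graftR (node l r) B = node l (graftR r B)

graftL : Tree → Tree → Tree
graftL A leaf       = A
graftL A (node l r) = node (graftL A l) r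

size-graftR : ∀ A B → size (graftR A B) ≡ size A + size B
size-graftR leaf       B = refl
size-graftR (node l r) B rewrite size-graftR r B = cong suc (sym (ℕ.+-assoc (size l) (size r) (size B)))

size-graftL : ∀ A B → size (graftL A B) ≡ size A + size B
size-graftL A leaf       = sym (ℕ.+-identityʳ (size A))
size-graftL A (node l r) rewrite size-graftL A l | ℕ.+-assoc (size A) (size l) (size r) =
  sym (+-suc (size A) (size l + size r))

readW-graftR : ∀ j A B → readW j (graftR A B) ≡ readW (j + size A) B ++ readW j A
readW-graftR j leaf       B rewrite ℕ.+-identityʳ j | ++-identityʳ (readW j B) = refl
readW-graftR j (node l r) B rewrite readW-graftR (suc (j + size l)) r B | +-suc-assoc j (size l) (size r) =
  ++-assoc (readW (j + suc (size l + size r)) B) (readW (suc (j + size l)) r) _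

wT-graftR : ∀ A B → wT (graftR A B) ≡ map (size A +_) (wT B) ++ wT A
wT-graftR A B = trans (readW-graftR 0 A B) (cong (_++ wT A) (readW≡shift-wT (size A) B))

lettersUpTo-all : ∀ {k xs} → All (_≤ k) xs → lettersUpTo k xs ≡ xs
lettersUpTo-all = filter-all (_≤? _)

lettersUpTo-none : ∀ {k xs} → All (k <_) xs → lettersUpTo k xs ≡ []
lettersUpTo-none = filter-none (_≤? _) ∘ All.map <⇒≱

lettersAbove-all : ∀ {k xs} → All (k <_) xs → lettersAbove k xs ≡ xs
lettersAbove-all = filter-all _ ∘ All.map <⇒≱

lettersAbove-none : ∀ {k xs} → All (_≤ k) xs → lettersAbove k xs ≡ []
lettersAbove-none = filter-none _ ∘ All.map (λ z≤k z≰k → z≰k z≤k)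

filter-readW-node : ∀ {p} {P : ℕ → Set p} (P? : Decidable P) j l r →
  filter P? (readW j (node l r)) ≡
  filter P? (readW (suc (j + size l)) r) ++ filter P? (readW j l) ++ filter P? (suc (j + size l) ∷ [])
filter-readW-node P? j l r =
  trans (filter-++ P? (readW (suc (j + size l)) r) _)
        (cong (filter P? (readW (suc (j + size l)) r) ++_) (filter-++ P? (readW j l) _))

-- lowerTree n T and upperTree n T are the subtrees spanned by the first n nodes of T in in-order and by the others.

lowerTree upperTree : ℕ → Tree → Tree
lowerTree n leaf       = leaf
lowerTree n (node l r) = if suc (size l) ≤ᵇ n then node l (lowerTree (n ∸ suc (size l)) r) else lowerTree n l
upperTree n leaf       = leaf
upperTree n (node l r) = if suc (size l) ≤ᵇ n then upperTree (n ∸ suc (size l)) r else node (upperTree n l) r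

+-∸-split : ∀ j sl n → suc sl ≤ n → j + n ≡ suc (j + sl) + (n ∸ suc sl)
+-∸-split j sl n sl<n = trans (cong (j +_) (sym (m+[n∸m]≡n sl<n)))
  (trans (sym (ℕ.+-assoc j (suc sl) (n ∸ suc sl))) (cong (_+ (n ∸ suc sl)) (+-suc j sl)))

lettersUpTo-readW : ∀ j n T → lettersUpTo (j + n) (readW j T) ≡ readW j (lowerTree n T)
lettersUpTo-readW j n leaf = refl
lettersUpTo-readW j n (node l r) with suc (size l) ≤ᵇ n in e
... | true  = trans (filter-readW-node (_≤? j + n) j l r) (cong₂ _++_ inR (cong₂ _++_ inL root))
  where
  sl<n = ≤ᵇ≡true⇒≤ e
  x = suc (j + size l)
  inR : lettersUpTo (j + n) (readW x r) ≡ readW x (lowerTree (n ∸ suc (size l)) r)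
  inR rewrite +-∸-split j (size l) n sl<n = lettersUpTo-readW x (n ∸ suc (size l)) r
  inL : lettersUpTo (j + n) (readW j l) ≡ readW j l
  inL = lettersUpTo-all (All.map (λ q → ≤-trans q (+-monoʳ-≤ j (≤-trans (n≤1+n _) sl<n))) (readW-upperBound j l))
  root : lettersUpTo (j + n) (x ∷ []) ≡ x ∷ []
  root = lettersUpTo-all (≤-trans (≤-reflexive (sym (+-suc j (size l)))) (+-monoʳ-≤ j sl<n) ∷ [])
... | false = trans (filter-readW-node (_≤? j + n) j l r)
                (trans (cong₂ _++_ inR (cong₂ _++_ (lettersUpTo-readW j n l) root)) (++-identityʳ _))
  where
  x = suc (j + size l)
  j+n<x : j + n < x
  j+n<x = s≤s (+-monoʳ-≤ j (≤-pred (≤ᵇ≡false⇒> e)))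
  inR : lettersUpTo (j + n) (readW x r) ≡ []
  inR = lettersUpTo-none (All.map (<-trans j+n<x) (readW-lowerBound x r))
  root : lettersUpTo (j + n) (x ∷ []) ≡ []
  root = lettersUpTo-none (j+n<x ∷ [])

size-upperTree : ∀ n T → size (upperTree n T) ≡ size T ∸ n
size-upperTree n leaf = sym (0∸n≡0 n)
size-upperTree n (node l r) with suc (size l) ≤ᵇ n in e
... | true  = begin
  size (upperTree (n ∸ l') r)              ≡⟨ size-upperTree (n ∸ l') r ⟩
  size r ∸ (n ∸ l')                        ≡⟨ cong (_∸ (n ∸ l')) (sym (m+n∸m≡n l' (size r))) ⟩
  (l' + size r) ∸ l' ∸ (n ∸ l')            ≡⟨ ∸-+-assoc (l' + size r) l' (n ∸ l') ⟩
  (l' + size r) ∸ (l' + (n ∸ l'))          ≡⟨ cong (l' + size r ∸_) (m+[n∸m]≡n {l'} {n} (≤ᵇ≡true⇒≤ e)) ⟩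
  (l' + size r) ∸ n                        ∎
  where
  open ≡-Reasoning
  l' = suc (size l)
... | false rewrite size-upperTree n l =
  trans (cong suc (sym (+-∸-comm (size r) n≤l))) (sym (+-∸-assoc 1 (≤-trans n≤l (m≤m+n (size l) (size r)))))
  where
  n≤l : n ≤ size l
  n≤l = ≤-pred (≤ᵇ≡false⇒> e)

lettersAbove-readW : ∀ j n T → lettersAbove (j + n) (readW j T) ≡ readW (j + n) (upperTree n T)
lettersAbove-readW j n leaf = refl
lettersAbove-readW j n (node l r) with suc (size l) ≤ᵇ n in e
... | true  = trans (filter-readW-node (λ z → ¬? (z ≤? j + n)) j l r)
                (trans (cong₂ _++_ inR (cong₂ _++_ inL root)) (++-identityʳ _))
  where
  sl<n = ≤ᵇ≡true⇒≤ e
  x = suc (j + size l)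
  inR : lettersAbove (j + n) (readW x r) ≡ readW (j + n) (upperTree (n ∸ suc (size l)) r)
  inR rewrite +-∸-split j (size l) n sl<n = lettersAbove-readW x (n ∸ suc (size l)) r
  inL : lettersAbove (j + n) (readW j l) ≡ []
  inL = lettersAbove-none (All.map (λ q → ≤-trans q (+-monoʳ-≤ j (≤-trans (n≤1+n _) sl<n))) (readW-upperBound j l))
  root : lettersAbove (j + n) (x ∷ []) ≡ []
  root = lettersAbove-none (≤-trans (≤-reflexive (sym (+-suc j (size l)))) (+-monoʳ-≤ j sl<n) ∷ [])
... | false = trans (filter-readW-node (λ z → ¬? (z ≤? j + n)) j l r)
                (trans (cong₂ _++_ inR (cong₂ _++_ (lettersAbove-readW j n l) root))
                       (cong (λ m → readW m r ++ readW (j + n) (upperTree n l) ++ m ∷ []) (sym root≡)))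
  where
  n≤l : n ≤ size l
  n≤l = ≤-pred (≤ᵇ≡false⇒> e)
  x = suc (j + size l)
  j+n<x : j + n < x
  j+n<x = s≤s (+-monoʳ-≤ j n≤l)
  root≡ : suc (j + n + size (upperTree n l)) ≡ x
  root≡ rewrite size-upperTree n l | ℕ.+-assoc j n (size l ∸ n) | m+[n∸m]≡n n≤l = refl
  inR : lettersAbove (j + n) (readW x r) ≡ readW x r
  inR = lettersAbove-all (All.map (<-trans j+n<x) (readW-lowerBound x r))
  root : lettersAbove (j + n) (x ∷ []) ≡ x ∷ []
  root = lettersAbove-all (j+n<x ∷ [])

lettersUpTo-wT : ∀ k T → lettersUpTo k (wT T) ≡ wT (lowerTree k T)
lettersUpTo-wT = lettersUpTo-readW 0

lettersAbove-wT : ∀ k T → lettersAbove k (wT T) ≡ map (k +_) (wT (upperTree k T))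
lettersAbove-wT k T = trans (lettersAbove-readW 0 k T) (readW≡shift-wT k (upperTree k T))

lowerTree-0 : ∀ T → lowerTree 0 T ≡ leaf
lowerTree-0 leaf       = refl
lowerTree-0 (node l r) = lowerTree-0 l

upperTree-0 : ∀ T → upperTree 0 T ≡ T
upperTree-0 leaf       = refl
upperTree-0 (node l r) = cong (λ t → node t r) (upperTree-0 l)

lowerTree-≥size : ∀ n T → size T ≤ n → lowerTree n T ≡ T
lowerTree-≥size n leaf       _ = refl
lowerTree-≥size n (node l r) T≤n rewrite ≤⇒≤ᵇ≡true (≤-trans (s≤s (m≤m+n (size l) (size r))) T≤n) =
  cong (node l) (lowerTree-≥size (n ∸ suc (size l)) r
    (≤-trans (≤-reflexive (sym (m+n∸m≡n (suc (size l)) (size r)))) (∸-monoˡ-≤ (suc (size l)) T≤n)))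

size≡0⇒leaf : ∀ {T} → size T ≡ 0 → T ≡ leaf
size≡0⇒leaf {leaf} _ = refl

upperTree≡leaf⇔ : ∀ n T → (upperTree n T ≡ leaf → size T ≤ n) × (size T ≤ n → upperTree n T ≡ leaf)
upperTree≡leaf⇔ n T =
  (λ e → m∸n≡0⇒m≤n (trans (sym (size-upperTree n T)) (cong size e))) ,
  (λ T≤n → size≡0⇒leaf (trans (size-upperTree n T) (m≤n⇒m∸n≡0 T≤n)))

size-lowerTree+size-upperTree : ∀ k T → size (lowerTree k T) + size (upperTree k T) ≡ size T
size-lowerTree+size-upperTree k T = begin
  size (lowerTree k T) + size (upperTree k T)
    ≡⟨ sym (cong₂ _+_ (trans (cong length (lettersUpTo-wT k T)) (length-readW 0 (lowerTree k T)))
                      (trans (cong length (lettersAbove-wT k T))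
                             (trans (length-map (k +_) (wT (upperTree k T))) (length-readW 0 (upperTree k T))))) ⟩
  length (lettersUpTo k (wT T)) + length (lettersAbove k (wT T))
    ≡⟨ length-split (wT T) ⟩
  length (wT T)
    ≡⟨ length-readW 0 T ⟩
  size T ∎
  where
  open ≡-Reasoning
  length-split : ∀ xs → length (lettersUpTo k xs) + length (lettersAbove k xs) ≡ length xs
  length-split []       = refl
  length-split (x ∷ xs) with x ≤ᵇ k
  ... | true  = cong suc (length-split xs)
  ... | false = trans (+-suc _ _) (cong suc (length-split xs))

bst-lnode : ∀ L x R u → foldr bstInsert (lnode L x R) u ≡
  lnode (foldr bstInsert L (lettersUpTo x u)) x (foldr bstInsert R (lettersAbove x u))
bst-lnode L x R []      = refl
bst-lnode L x R (y ∷ u) rewrite bst-lnode L x R u with y ≤ᵇ x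
... | true  = refl
... | false = refl

shape-bst-readW : ∀ j T → shape (bst (readW j T)) ≡ T
shape-bst-readW j leaf       = refl
shape-bst-readW j (node l r) = begin
  shape (foldr bstInsert lleaf (R ++ Lw ++ x ∷ []))
    ≡⟨ cong shape (foldr-++ bstInsert lleaf R (Lw ++ x ∷ [])) ⟩
  shape (foldr bstInsert (foldr bstInsert lleaf (Lw ++ x ∷ [])) R)
    ≡⟨ cong (λ t → shape (foldr bstInsert t R)) (foldr-++ bstInsert lleaf Lw (x ∷ [])) ⟩
  shape (foldr bstInsert (foldr bstInsert (lnode lleaf x lleaf) Lw) R)
    ≡⟨ cong shape (sym (foldr-++ bstInsert (lnode lleaf x lleaf) R Lw)) ⟩
  shape (foldr bstInsert (lnode lleaf x lleaf) (R ++ Lw))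
    ≡⟨ cong shape (bst-lnode lleaf x lleaf (R ++ Lw)) ⟩
  node (shape (bst (lettersUpTo x (R ++ Lw)))) (shape (bst (lettersAbove x (R ++ Lw))))
    ≡⟨ cong₂ node (trans (cong (shape ∘ bst) upTo) (shape-bst-readW j l))
                  (trans (cong (shape ∘ bst) above) (shape-bst-readW x r)) ⟩
  node l r ∎
  where
  open ≡-Reasoning
  x = suc (j + size l)
  R = readW x r
  Lw = readW j l
  Lw≤x : All (_≤ x) Lw
  Lw≤x = All.map (λ q → ≤-trans q (n≤1+n _)) (readW-upperBound j l)
  upTo : lettersUpTo x (R ++ Lw) ≡ Lw
  upTo = trans (filter-++ (_≤? x) R Lw)
    (cong₂ _++_ (lettersUpTo-none (readW-lowerBound x r)) (lettersUpTo-all Lw≤x))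
  above : lettersAbove x (R ++ Lw) ≡ R
  above = trans (filter-++ _ R Lw)
    (trans (cong₂ _++_ (lettersAbove-all (readW-lowerBound x r)) (lettersAbove-none Lw≤x)) (++-identityʳ R))

wT-injective : ∀ {S T} → wT S ≡ wT T → S ≡ T
wT-injective {S} {T} e = trans (sym (shape-bst-readW 0 S)) (trans (cong (shape ∘ bst) e) (shape-bst-readW 0 T))

indicator : Bool → ℕ
indicator b = if b then 1 else 0

sumℕ : {A : Set} → (A → ℕ) → List A → ℕ
sumℕ f []       = 0
sumℕ f (x ∷ xs) = f x + sumℕ f xs

sumℕ-++ : {A : Set} (f : A → ℕ) (xs ys : List A) → sumℕ f (xs ++ ys) ≡ sumℕ f xs + sumℕ f ys
sumℕ-++ f []       ys = refl
sumℕ-++ f (x ∷ xs) ys = trans (cong (f x +_) (sumℕ-++ f xs ys)) (sym (ℕ.+-assoc (f x) _ _))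

sumℕ-concatMap : {A B : Set} (f : B → ℕ) (g : A → List B) (xs : List A) →
  sumℕ f (concatMap g xs) ≡ sumℕ (sumℕ f ∘ g) xs
sumℕ-concatMap f g []       = refl
sumℕ-concatMap f g (x ∷ xs) = trans (sumℕ-++ f (g x) (concatMap g xs)) (cong (sumℕ f (g x) +_) (sumℕ-concatMap f g xs))

sumℕ-cong : {A : Set} {f g : A → ℕ} (xs : List A) → (∀ {x} → x ∈ xs → f x ≡ g x) → sumℕ f xs ≡ sumℕ g xs
sumℕ-cong []       f≗g = refl
sumℕ-cong (x ∷ xs) f≗g = cong₂ _+_ (f≗g (here refl)) (sumℕ-cong xs (f≗g ∘ there))

sumℕ-filterᵇ : {A : Set} (f : A → ℕ) (p : A → Bool) (xs : List A) →
  sumℕ f (filterᵇ p xs) ≡ sumℕ (λ x → if p x then f x else 0) xs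
sumℕ-filterᵇ f p []       = refl
sumℕ-filterᵇ f p (x ∷ xs) with p x
... | true  = cong (f x +_) (sumℕ-filterᵇ f p xs)
... | false = sumℕ-filterᵇ f p xs

length-filterᵇ : {A : Set} (p : A → Bool) (xs : List A) → length (filterᵇ p xs) ≡ sumℕ (indicator ∘ p) xs
length-filterᵇ p []       = refl
length-filterᵇ p (x ∷ xs) with p x
... | true  = cong suc (length-filterᵇ p xs)
... | false = length-filterᵇ p xs


indicator-∧ : ∀ a b → indicator (a ∧ b) ≡ indicator a * indicator b
indicator-∧ true  b = sym (ℕ.+-identityʳ _)
indicator-∧ false b = refl

sumℕ-*ˡ : {A : Set} (c : ℕ) (f : A → ℕ) (L : List A) → sumℕ (λ x → c * f x) L ≡ c * sumℕ f L
sumℕ-*ˡ c f []      = sym (*-zeroʳ c)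
sumℕ-*ˡ c f (x ∷ L) = trans (cong (c * f x +_) (sumℕ-*ˡ c f L)) (sym (*-distribˡ-+ c (f x) (sumℕ f L)))

sumℕ-*ʳ : {A : Set} (c : ℕ) (f : A → ℕ) (L : List A) → sumℕ (λ x → f x * c) L ≡ sumℕ f L * c
sumℕ-*ʳ c f []      = refl
sumℕ-*ʳ c f (x ∷ L) = trans (cong (f x * c +_) (sumℕ-*ʳ c f L)) (sym (*-distribʳ-+ c (f x) (sumℕ f L)))

sumℕ-product : {A B : Set} (f : A → ℕ) (g : B → ℕ) (L : List A) (M : List B) →
  sumℕ (λ x → sumℕ (λ y → f x * g y) M) L ≡ sumℕ f L * sumℕ g M
sumℕ-product f g L M = trans (sumℕ-cong L (λ {x} _ → sumℕ-*ˡ (f x) g M)) (sumℕ-*ʳ (sumℕ g M) f L)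

count : {A : Set} → DecidableEquality A → A → List A → ℕ
count _≟_ x = sumℕ (λ u → indicator (does (x ≟ u)))

count-filterᵇ : {A : Set} (_≟_ : DecidableEquality A) (x : A) (p : A → Bool) (L : List A) →
  count _≟_ x (filterᵇ p L) ≡ count _≟_ x L * indicator (p x)
count-filterᵇ _≟_ x p L =
  trans (sumℕ-filterᵇ _ p L) (trans (sumℕ-cong L (λ {u} _ → pointwise u)) (sumℕ-*ʳ _ _ L))
  where
  pointwise : ∀ u → (if p u then indicator (does (x ≟ u)) else 0) ≡ indicator (does (x ≟ u)) * indicator (p x)
  pointwise u with x ≟ u
  ... | yes refl with p x
  ...   | true  = refl
  ...   | false = refl
  pointwise u | no _ with p u
  ...   | true  = refl
  ...   | false = refl

multiplicity : ℕ → List ℕ → ℕ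
multiplicity = count _≟_

occurrences : List ℕ → List (List ℕ) → ℕ
occurrences = count _≟ᴸ_

between : ℕ → ℕ → ℕ → Bool
between lo hi a = (suc lo ≤ᵇ a) ∧ (a ≤ᵇ hi)

between-empty : ∀ j a → between j j a ≡ false
between-empty j a with a ≤? j
... | yes a≤j rewrite >⇒≤ᵇ≡false {suc j} {a} (s≤s a≤j) = refl
... | no  a≰j rewrite >⇒≤ᵇ≡false (≰⇒> a≰j) = ∧-zeroʳ _

between-split : ∀ {lo mid hi} a → lo ≤ mid → mid ≤ hi →
  indicator (between lo mid a) + indicator (between mid hi a) ≡ indicator (between lo hi a)
between-split {lo} {mid} {hi} a lo≤mid mid≤hi with a ≤? mid
... | yes a≤mid
  rewrite ≤⇒≤ᵇ≡true a≤mid | >⇒≤ᵇ≡false {suc mid} {a} (s≤s a≤mid) | ≤⇒≤ᵇ≡true (≤-trans a≤mid mid≤hi) = ℕ.+-identityʳ _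
... | no a≰mid
  rewrite >⇒≤ᵇ≡false (≰⇒> a≰mid) | ≤⇒≤ᵇ≡true (≰⇒> a≰mid) | ≤⇒≤ᵇ≡true (≤-<-trans lo≤mid (≰⇒> a≰mid)) = refl

≡ᵇ-between : ∀ a m → (a ≡ᵇ suc m) ≡ between m (suc m) a
≡ᵇ-between a m with <-cmp a (suc m)
... | tri< a<m' _ _ rewrite ≢⇒≡ᵇ≡false (<⇒≢ a<m') | >⇒≤ᵇ≡false {suc m} {a} a<m' = refl
... | tri≈ _ refl _ rewrite ≡ᵇ-refl a | ≤⇒≤ᵇ≡true (≤-refl {a}) = refl
... | tri> _ _ m'<a rewrite ≢⇒≡ᵇ≡false (<⇒≢ m'<a ∘ sym) | >⇒≤ᵇ≡false m'<a | ≤⇒≤ᵇ≡true (<⇒≤ m'<a) = refl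

multiplicity-readW : ∀ j T a → multiplicity a (readW j T) ≡ indicator (between j (j + size T) a)
multiplicity-readW j leaf       a rewrite ℕ.+-identityʳ j | between-empty j a = refl
multiplicity-readW j (node l r) a = begin
  multiplicity a (readW x r ++ readW j l ++ x ∷ [])
    ≡⟨ trans (sumℕ-++ _ (readW x r) _) (cong (multiplicity a (readW x r) +_) (sumℕ-++ _ (readW j l) (x ∷ []))) ⟩
  multiplicity a (readW x r) + (multiplicity a (readW j l) + (indicator (a ≡ᵇ x) + 0))
    ≡⟨ cong₂ _+_ (multiplicity-readW x r a)
         (cong₂ _+_ (multiplicity-readW j l a) (trans (ℕ.+-identityʳ _) (cong indicator (≡ᵇ-between a (j + size l))))) ⟩
  indicator (between x (x + size r) a) + (indicator (between j (j + size l) a) + indicator (between (j + size l) x a))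
    ≡⟨ cong (indicator (between x (x + size r) a) +_) (between-split a (m≤m+n j (size l)) (n≤1+n _)) ⟩
  indicator (between x (x + size r) a) + indicator (between j x a)
    ≡⟨ trans (ℕ.+-comm (indicator (between x (x + size r) a)) _)
             (between-split a (≤-trans (m≤m+n j (size l)) (n≤1+n _)) (m≤m+n x (size r))) ⟩
  indicator (between j (x + size r) a)
    ≡⟨ cong (λ m → indicator (between j m a)) (+-suc-assoc j (size l) (size r)) ⟩
  indicator (between j (j + size (node l r)) a) ∎
  where
  open ≡-Reasoning
  x = suc (j + size l)

IsPermutation : ℕ → List ℕ → Set
IsPermutation n π = ∀ a → multiplicity a π ≡ indicator (between 0 n a)

wT-isPermutation : ∀ T → IsPermutation (size T) (wT T)
wT-isPermutation = multiplicity-readW 0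

removeLetter : ℕ → List ℕ → List ℕ
removeLetter a = filterᵇ (λ z → not (a ≡ᵇ z))

removeLetter-absent : ∀ a π → multiplicity a π ≡ 0 → removeLetter a π ≡ π
removeLetter-absent a []      _ = refl
removeLetter-absent a (z ∷ π) e with a ≡ᵇ z
... | false = cong (z ∷_) (removeLetter-absent a π e)

multiplicity-removeLetter : ∀ a b π → multiplicity b (removeLetter a π) ≡ (if b ≡ᵇ a then 0 else multiplicity b π)
multiplicity-removeLetter a b []      with b ≡ᵇ a
... | true  = refl
... | false = refl
multiplicity-removeLetter a b (z ∷ π) with a ≟ z
... | yes refl rewrite ≡ᵇ-refl a | multiplicity-removeLetter a b π with b ≡ᵇ a
...   | true  = refl
...   | false = refl
multiplicity-removeLetter a b (z ∷ π) | no a≢z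
  rewrite ≢⇒≡ᵇ≡false a≢z | multiplicity-removeLetter a b π with b ≡ᵇ a in b≡a
...   | true  rewrite ≢⇒≡ᵇ≡false {b} {z} (a≢z ∘ trans (sym (≡ᵇ≡true⇒≡ b≡a))) = refl
...   | false = refl

occurrences-map-∷ : ∀ z π x L → occurrences (z ∷ π) (map (x ∷_) L) ≡ (if z ≡ᵇ x then occurrences π L else 0)
occurrences-map-∷ z π x []      with z ≡ᵇ x
... | true  = refl
... | false = refl
occurrences-map-∷ z π x (u ∷ L) rewrite occurrences-map-∷ z π x L with z ≡ᵇ x
... | true  = refl
... | false = refl

occurrences-insertAll : ∀ a ρ π → multiplicity a π ≡ 1 → multiplicity a ρ ≡ 0 →
  occurrences π (insertAll a ρ) ≡ indicator (eqListℕ (removeLetter a π) ρ)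
occurrences-insertAll a ρ (z ∷ π) once absent with a ≟ z
occurrences-insertAll a [] (a ∷ π) once absent | yes refl
  rewrite ≡ᵇ-refl a | removeLetter-absent a π (suc-injective once) = ℕ.+-identityʳ _
occurrences-insertAll a (x ∷ xs) (a ∷ π) once absent | yes refl
  rewrite ≡ᵇ-refl a | removeLetter-absent a π (suc-injective once) | occurrences-map-∷ a π x (insertAll a xs)
  with a ≡ᵇ x
... | false = ℕ.+-identityʳ _
occurrences-insertAll a [] (z ∷ π) once absent | no a≢z
  rewrite ≢⇒≡ᵇ≡false a≢z | ≢⇒≡ᵇ≡false (a≢z ∘ sym) = refl
occurrences-insertAll a (x ∷ xs) (z ∷ π) once absent | no a≢z
  rewrite ≢⇒≡ᵇ≡false a≢z | ≢⇒≡ᵇ≡false (a≢z ∘ sym) | occurrences-map-∷ z π x (insertAll a xs)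
  with z ≡ᵇ x | a ≡ᵇ x
... | true  | false = occurrences-insertAll a xs π once absent
... | false | _     = refl

insertAll-All : ∀ {P : ℕ → Set} a ρ₀ {ρ} → ρ ∈ insertAll a ρ₀ → All P ρ₀ → P a → All P ρ
insertAll-All a []       (here refl) _          pa = pa ∷ []
insertAll-All a (x ∷ xs) (here refl) all        pa = pa ∷ all
insertAll-All a (x ∷ xs) (there ρ∈) (px ∷ all) pa with ∈-map⁻ (x ∷_) ρ∈
... | _ , ρ'∈ , refl = px ∷ insertAll-All a xs ρ'∈ all pa

perms-letters : ∀ n {ρ} → ρ ∈ perms n → All (λ z → 1 ≤ z × z ≤ n) ρ
perms-letters zero    (here refl) = []
perms-letters (suc n) ρ∈ with find (∈-concatMap⁻ (insertAll (suc n)) ρ∈)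
... | ρ₀ , ρ₀∈ , ρ∈ins = insertAll-All (suc n) ρ₀ ρ∈ins
        (All.map (λ (p , q) → p , m≤n⇒m≤1+n q) (perms-letters n ρ₀∈)) (s≤s z≤n , ≤-refl)

IsPermutation-0 : ∀ π → IsPermutation 0 π → π ≡ []
IsPermutation-0 []      _      = refl
IsPermutation-0 (z ∷ π) isPerm with isPerm z
... | e rewrite ≡ᵇ-refl z | between-empty 0 z with () ← e

IsPermutation-removeLetter : ∀ m π → IsPermutation (suc m) π → IsPermutation m (removeLetter (suc m) π)
IsPermutation-removeLetter m π isPerm b rewrite multiplicity-removeLetter (suc m) b π with b ≟ suc m
... | yes refl rewrite ≡ᵇ-refl b | >⇒≤ᵇ≡false (n<1+n m) = refl
... | no  b≢m' rewrite ≢⇒≡ᵇ≡false b≢m' = begin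
  multiplicity b π                                                           ≡⟨ isPerm b ⟩
  indicator (between 0 (suc m) b)                                            ≡⟨ sym (between-split b z≤n (n≤1+n m)) ⟩
  indicator (between 0 m b) + indicator (between m (suc m) b)                ≡⟨ cong (plus ∘ indicator) (≡ᵇ-between b m) ⟨
  indicator (between 0 m b) + indicator (b ≡ᵇ suc m)                         ≡⟨ cong (plus ∘ indicator) (≢⇒≡ᵇ≡false b≢m') ⟩
  indicator (between 0 m b) + 0                                              ≡⟨ ℕ.+-identityʳ _ ⟩
  indicator (between 0 m b)                                                  ∎
  where
  open ≡-Reasoning
  plus = indicator (between 0 m b) +_

occurrences-perms : ∀ n π → IsPermutation n π → occurrences π (perms n) ≡ 1
occurrences-perms zero    π isPerm rewrite IsPermutation-0 π isPerm = refl
occurrences-perms (suc m) π isPerm = begin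
  occurrences π (concatMap (insertAll (suc m)) (perms m))
    ≡⟨ sumℕ-concatMap _ (insertAll (suc m)) (perms m) ⟩
  sumℕ (λ ρ → occurrences π (insertAll (suc m) ρ)) (perms m)
    ≡⟨ sumℕ-cong (perms m) (λ ρ∈ → occurrences-insertAll (suc m) _ π once (absent ρ∈)) ⟩
  occurrences (removeLetter (suc m) π) (perms m)
    ≡⟨ occurrences-perms m (removeLetter (suc m) π) (IsPermutation-removeLetter m π isPerm) ⟩
  1 ∎
  where
  open ≡-Reasoning
  once : multiplicity (suc m) π ≡ 1
  once rewrite isPerm (suc m) | ≤⇒≤ᵇ≡true (≤-refl {suc m}) = refl
  absent : ∀ {ρ} → ρ ∈ perms m → multiplicity (suc m) ρ ≡ 0
  absent ρ∈ = go (perms-letters m ρ∈)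
    where
    go : ∀ {ρ} → All (λ z → 1 ≤ z × z ≤ m) ρ → multiplicity (suc m) ρ ≡ 0
    go []              = refl
    go ((_ , z≤m) ∷ zs) rewrite ≢⇒≡ᵇ≡false (<⇒≢ (s≤s z≤m) ∘ sym) = go zs

occurrences-wT-perms : ∀ T → occurrences (wT T) (perms (size T)) ≡ 1
occurrences-wT-perms T = occurrences-perms (size T) (wT T) (wT-isPermutation T)

-- Structure constants of PBT in the basis (P_T)

occurrences-[]-map-∷ : ∀ x L → occurrences [] (map (x ∷_) L) ≡ 0
occurrences-[]-map-∷ x []      = refl
occurrences-[]-map-∷ x (u ∷ L) = occurrences-[]-map-∷ x L

≤<⇒≡ᵇ≡false : ∀ {k x y} → x ≤ k → k < y → (x ≡ᵇ y) ≡ false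
≤<⇒≡ᵇ≡false x≤k k<y = ≢⇒≡ᵇ≡false (<⇒≢ (≤-<-trans x≤k k<y))

eqListℕ-above : ∀ k π ρ → All (k <_) ρ →
  eqListℕ π ρ ≡ (eqListℕ (lettersUpTo k π) [] ∧ eqListℕ (lettersAbove k π) ρ)
eqListℕ-above k []      ρ       _           = refl
eqListℕ-above k (z ∷ π) ρ       k<ρ         with z ≤ᵇ k in z≤k
eqListℕ-above k (z ∷ π) []      _           | true  = refl
eqListℕ-above k (z ∷ π) (y ∷ ρ) (k<y ∷ _)   | true  = cong (_∧ eqListℕ π ρ) (≤<⇒≡ᵇ≡false (≤ᵇ≡true⇒≤ {z} {k} z≤k) k<y)
eqListℕ-above k (z ∷ π) []      _           | false = sym (∧-zeroʳ _)
eqListℕ-above k (z ∷ π) (y ∷ ρ) (_ ∷ k<ρ)  | false rewrite eqListℕ-above k π ρ k<ρ with z ≡ᵇ y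
... | true  = refl
... | false = sym (∧-zeroʳ _)

eqListℕ-upTo : ∀ k π σ → All (_≤ k) σ →
  eqListℕ π σ ≡ (eqListℕ (lettersUpTo k π) σ ∧ eqListℕ (lettersAbove k π) [])
eqListℕ-upTo k []      σ       _           = sym (∧-identityʳ _)
eqListℕ-upTo k (z ∷ π) σ       σ≤k         with z ≤ᵇ k in z≤k
eqListℕ-upTo k (z ∷ π) []      _           | true  = refl
eqListℕ-upTo k (z ∷ π) (y ∷ σ) (_ ∷ σ≤k)   | true  rewrite eqListℕ-upTo k π σ σ≤k with z ≡ᵇ y
... | true  = refl
... | false = refl
eqListℕ-upTo k (z ∷ π) []      _           | false = sym (∧-zeroʳ _)
eqListℕ-upTo k (z ∷ π) (y ∷ σ) (y≤k ∷ _)   | false =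
  trans (cong (_∧ eqListℕ π σ) (≢⇒≡ᵇ≡false (≢-sym (<⇒≢ (≤-<-trans y≤k (≤ᵇ≡false⇒> {z} {k} z≤k)))))) (sym (∧-zeroʳ _))

occurrences-shuffle : ∀ k π σ ρ → All (_≤ k) σ → All (k <_) ρ →
  occurrences π (shuffle σ ρ) ≡ indicator (eqListℕ (lettersUpTo k π) σ ∧ eqListℕ (lettersAbove k π) ρ)
occurrences-shuffle k π []      ρ       _   k<ρ = trans (ℕ.+-identityʳ _) (cong indicator (eqListℕ-above k π ρ k<ρ))
occurrences-shuffle k π (x ∷ σ) []      σ≤k _   = trans (ℕ.+-identityʳ _) (cong indicator (eqListℕ-upTo k π (x ∷ σ) σ≤k))
occurrences-shuffle k [] (x ∷ σ) (y ∷ ρ) _ _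
  rewrite sumℕ-++ (λ u → indicator (eqListℕ [] u)) (map (x ∷_) (shuffle σ (y ∷ ρ))) (map (y ∷_) (shuffle (x ∷ σ) ρ))
        | occurrences-[]-map-∷ x (shuffle σ (y ∷ ρ)) | occurrences-[]-map-∷ y (shuffle (x ∷ σ) ρ) = refl
occurrences-shuffle k (z ∷ π) (x ∷ σ) (y ∷ ρ) (x≤k ∷ σ≤k) (k<y ∷ k<ρ)
  rewrite sumℕ-++ (λ u → indicator (eqListℕ (z ∷ π) u)) (map (x ∷_) (shuffle σ (y ∷ ρ))) (map (y ∷_) (shuffle (x ∷ σ) ρ))
        | occurrences-map-∷ z π x (shuffle σ (y ∷ ρ)) | occurrences-map-∷ z π y (shuffle (x ∷ σ) ρ)
  with z ≤ᵇ k in z≤k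
... | true rewrite ≤<⇒≡ᵇ≡false (≤ᵇ≡true⇒≤ {z} {k} z≤k) k<y with z ≡ᵇ x
...   | true  = trans (ℕ.+-identityʳ _) (occurrences-shuffle k π σ (y ∷ ρ) σ≤k (k<y ∷ k<ρ))
...   | false = refl
occurrences-shuffle k (z ∷ π) (x ∷ σ) (y ∷ ρ) (x≤k ∷ σ≤k) (k<y ∷ k<ρ) | false
  rewrite ≢⇒≡ᵇ≡false (≢-sym (<⇒≢ (≤-<-trans x≤k (≤ᵇ≡false⇒> {z} {k} z≤k)))) with z ≡ᵇ y
...   | true  = occurrences-shuffle k π (x ∷ σ) ρ (x≤k ∷ σ≤k) k<ρ
...   | false = cong indicator (sym (∧-zeroʳ _))

occurrences-wT-cls : ∀ C A → occurrences (wT C) (cls A) ≡ indicator (eqTree C A)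
occurrences-wT-cls C A rewrite count-filterᵇ _≟ᴸ_ (wT C) (λ σ → eqTree (shape (bst σ)) A) (perms (size A))
                             | shape-bst-readW 0 C with eqTree C A in C≡A
... | true rewrite does-true⇒ (C ≟ᵀ A) C≡A | occurrences-wT-perms A = refl
... | false = *-zeroʳ (occurrences (wT C) (perms (size A)))

cls-letters : ∀ A {σ} → σ ∈ cls A → All (λ z → 1 ≤ z × z ≤ size A) σ
cls-letters A σ∈ = perms-letters (size A) (proj₁ (∈-filter⁻ (T? ∘ (λ σ → eqTree (shape (bst σ)) A)) σ∈))

eqListℕ-shift : ∀ k a b → eqListℕ (map (k +_) a) (map (k +_) b) ≡ eqListℕ a b
eqListℕ-shift k []      []      = refl
eqListℕ-shift k []      (_ ∷ _) = refl
eqListℕ-shift k (_ ∷ _) []      = refl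
eqListℕ-shift k (x ∷ a) (y ∷ b) = cong₂ _∧_ (≡ᵇ-shift k) (eqListℕ-shift k a b)
  where
  ≡ᵇ-shift : ∀ k → (k + x ≡ᵇ k + y) ≡ (x ≡ᵇ y)
  ≡ᵇ-shift zero    = refl
  ≡ᵇ-shift (suc k) = ≡ᵇ-shift k

structConst-formula : ∀ A B T →
  structConst A B T ≡ indicator (eqTree (lowerTree (size A) T) A ∧ eqTree (upperTree (size A) T) B)
structConst-formula A B T = begin
  length (filterᵇ (eqListℕ π) (concatMap shuffles (cls A)))
    ≡⟨ length-filterᵇ (eqListℕ π) (concatMap shuffles (cls A)) ⟩
  occurrences π (concatMap shuffles (cls A))
    ≡⟨ sumℕ-concatMap _ shuffles (cls A) ⟩
  sumℕ (λ σ → occurrences π (shuffles σ)) (cls A)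
    ≡⟨ sumℕ-cong (cls A) (λ {σ} σ∈ → trans (sumℕ-concatMap _ (λ τ → shuffle σ (shift k τ)) (cls B))
                                           (sumℕ-cong (cls B) (split σ∈))) ⟩
  sumℕ (λ σ → sumℕ (λ τ → indicator (eqListℕ (wT C) σ) * indicator (eqListℕ (wT D) τ)) (cls B)) (cls A)
    ≡⟨ sumℕ-product _ _ (cls A) (cls B) ⟩
  occurrences (wT C) (cls A) * occurrences (wT D) (cls B)
    ≡⟨ cong₂ _*_ (occurrences-wT-cls C A) (occurrences-wT-cls D B) ⟩
  indicator (eqTree C A) * indicator (eqTree D B)
    ≡⟨ sym (indicator-∧ (eqTree C A) (eqTree D B)) ⟩
  indicator (eqTree C A ∧ eqTree D B) ∎
  where
  open ≡-Reasoning
  k = size A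
  π = wT T
  C = lowerTree k T
  D = upperTree k T
  shuffles : List ℕ → List (List ℕ)
  shuffles σ = concatMap (λ τ → shuffle σ (shift k τ)) (cls B)
  split : ∀ {σ τ} → σ ∈ cls A → τ ∈ cls B →
    occurrences π (shuffle σ (shift k τ)) ≡ indicator (eqListℕ (wT C) σ) * indicator (eqListℕ (wT D) τ)
  split {σ} {τ} σ∈ τ∈ = begin
    occurrences π (shuffle σ (shift k τ))
      ≡⟨ occurrences-shuffle k π σ (shift k τ) (All.map proj₂ (cls-letters A σ∈)) (shifted (cls-letters B τ∈)) ⟩
    indicator (eqListℕ (lettersUpTo k π) σ ∧ eqListℕ (lettersAbove k π) (shift k τ))
      ≡⟨ cong₂ (λ u v → indicator (eqListℕ u σ ∧ v)) (lettersUpTo-wT k T)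
               (trans (cong (λ u → eqListℕ u (shift k τ)) (lettersAbove-wT k T)) (eqListℕ-shift k (wT D) τ)) ⟩
    indicator (eqListℕ (wT C) σ ∧ eqListℕ (wT D) τ)
      ≡⟨ indicator-∧ (eqListℕ (wT C) σ) (eqListℕ (wT D) τ) ⟩
    indicator (eqListℕ (wT C) σ) * indicator (eqListℕ (wT D) τ) ∎
    where
    shifted : ∀ {τ} → All (λ z → 1 ≤ z × z ≤ size B) τ → All (k <_) (shift k τ)
    shifted []             = []
    shifted ((1≤z , _) ∷ zs) = m<m+n k 1≤z ∷ shifted zs

structConst-leafˡ : ∀ B T → structConst leaf B T ≡ indicator (eqTree T B)
structConst-leafˡ B T rewrite structConst-formula leaf B T | lowerTree-0 T | upperTree-0 T = refl

structConst-leafʳ : ∀ A T → structConst A leaf T ≡ indicator (eqTree T A)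
structConst-leafʳ A T = trans (structConst-formula A leaf T) (cong indicator (sym (≡∧-intro ⇒ ⇐)))
  where
  ⇒ : eqTree T A ≡ true → eqTree (lowerTree (size A) T) A ≡ true × eqTree (upperTree (size A) T) leaf ≡ true
  ⇒ T≡A rewrite does-true⇒ (T ≟ᵀ A) T≡A | lowerTree-≥size (size A) A ≤-refl | proj₂ (upperTree≡leaf⇔ (size A) A) ≤-refl =
    eqTree-refl A , refl
  ⇐ : eqTree (lowerTree (size A) T) A ≡ true → eqTree (upperTree (size A) T) leaf ≡ true → eqTree T A ≡ true
  ⇐ lower≡A upper≡leaf
    rewrite lowerTree-≥size (size A) T (proj₁ (upperTree≡leaf⇔ (size A) T) (does-true⇒ (_ ≟ᵀ leaf) upper≡leaf)) = lower≡A

data Before (u v : ℕ) : List ℕ → Set where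
  first : ∀ {xs}   → v ∈ xs → Before u v (u ∷ xs)
  later : ∀ {x xs} → Before u v xs → Before u v (x ∷ xs)

Before-∈ˡ : ∀ {u v xs} → Before u v xs → u ∈ xs
Before-∈ˡ (first _) = here refl
Before-∈ˡ (later b) = there (Before-∈ˡ b)

Before-∈ʳ : ∀ {u v xs} → Before u v xs → v ∈ xs
Before-∈ʳ (first v∈) = there v∈
Before-∈ʳ (later b)  = there (Before-∈ʳ b)

Before-++ˡ : ∀ {u v xs} ys → Before u v xs → Before u v (xs ++ ys)
Before-++ˡ ys (first v∈) = first (∈-++⁺ˡ v∈)
Before-++ˡ ys (later b)  = later (Before-++ˡ ys b)

Before-++ʳ : ∀ {u v ys} xs → Before u v ys → Before u v (xs ++ ys)
Before-++ʳ []       b = b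
Before-++ʳ (x ∷ xs) b = later (Before-++ʳ xs b)

Before-++-across : ∀ {u v} xs {ys} → u ∈ xs → v ∈ ys → Before u v (xs ++ ys)
Before-++-across (x ∷ xs) (here refl) v∈ = first (∈-++⁺ʳ xs v∈)
Before-++-across (x ∷ xs) (there u∈) v∈ = later (Before-++-across xs u∈ v∈)

Before-++⁻ : ∀ {u v} xs {ys} → Before u v (xs ++ ys) → Before u v xs ⊎ (u ∈ xs × v ∈ ys) ⊎ Before u v ys
Before-++⁻ []       b = inj₂ (inj₂ b)
Before-++⁻ (x ∷ xs) (first v∈) with ∈-++⁻ xs v∈
... | inj₁ v∈xs = inj₁ (first v∈xs)
... | inj₂ v∈ys = inj₂ (inj₁ (here refl , v∈ys))
Before-++⁻ (x ∷ xs) (later b) with Before-++⁻ xs b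
... | inj₁ b'               = inj₁ (later b')
... | inj₂ (inj₁ (u∈ , v∈)) = inj₂ (inj₁ (there u∈ , v∈))
... | inj₂ (inj₂ b')        = inj₂ (inj₂ b')

¬Before-[_] : ∀ {u v} x → ¬ Before u v (x ∷ [])
¬Before-[ x ] (first ())
¬Before-[ x ] (later ())

Before-filter⁺ : ∀ {p} {P : ℕ → Set p} (P? : Decidable P) {u v} xs → P u → P v → Before u v xs → Before u v (filter P? xs)
Before-filter⁺ P? (x ∷ xs) pu pv (first v∈) with P? x
... | yes _  = first (∈-filter⁺ P? v∈ pv)
... | no ¬pu = contradiction pu ¬pu
Before-filter⁺ P? (x ∷ xs) pu pv (later b) with does (P? x)
... | true  = later (Before-filter⁺ P? xs pu pv b)
... | false = Before-filter⁺ P? xs pu pv b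

Before-filter⁻ : ∀ {p} {P : ℕ → Set p} (P? : Decidable P) {u v} xs → Before u v (filter P? xs) → Before u v xs
Before-filter⁻ P? (x ∷ xs) b with does (P? x)
Before-filter⁻ P? (x ∷ xs) (first v∈) | true = first (proj₁ (∈-filter⁻ P? v∈))
Before-filter⁻ P? (x ∷ xs) (later b)  | true = later (Before-filter⁻ P? xs b)
... | false = later (Before-filter⁻ P? xs b)

Before-total : ∀ {u v} xs → u ∈ xs → v ∈ xs → u ≢ v → Before u v xs ⊎ Before v u xs
Before-total (x ∷ xs) (here refl) (here refl) u≢v = contradiction refl u≢v
Before-total (x ∷ xs) (here refl) (there v∈) _   = inj₁ (first v∈)
Before-total (x ∷ xs) (there u∈) (here refl) _   = inj₂ (first u∈)
Before-total (x ∷ xs) (there u∈) (there v∈) u≢v with Before-total xs u∈ v∈ u≢v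
... | inj₁ b = inj₁ (later b)
... | inj₂ b = inj₂ (later b)

-- A step of the weak order creates one inversion and destroys none.
Weak-preservesInversion : ∀ {σ τ a b} → Weak σ τ → a < b → Before b a σ → Before b a τ
Weak-preservesInversion ε       _   inv = inv
Weak-preservesInversion (s ◅ w) a<b inv = Weak-preservesInversion w a<b (Step-inv s inv)
  where
  Step-∈ : ∀ {σ σ' x} → Step σ σ' → x ∈ σ → x ∈ σ'
  Step-∈ (swap _) (here refl)         = there (here refl)
  Step-∈ (swap _) (there (here refl)) = here refl
  Step-∈ (swap _) (there (there x∈))  = there (there x∈)
  Step-∈ (skip s) (here refl)         = here refl
  Step-∈ (skip s) (there x∈)          = there (Step-∈ s x∈)
  Step-inv : ∀ {σ σ'} → Step σ σ' → Before _ _ σ → Before _ _ σ'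
  Step-inv (swap y<x) (first (here refl)) = contradiction y<x (<-asym a<b)
  Step-inv (swap _)   (first (there a∈))  = later (first a∈)
  Step-inv (swap _)   (later (first a∈))  = first (there a∈)
  Step-inv (swap _)   (later (later i))   = later (later i)
  Step-inv (skip s)   (first a∈)          = first (Step-∈ s a∈)
  Step-inv (skip s)   (later i)           = later (Step-inv s i)

Inversions⊆ : List ℕ → List ℕ → Set
Inversions⊆ σ τ = ∀ a b → a < b → Before b a σ → Before b a τ

∈⇒1≤multiplicity : ∀ {x xs} → x ∈ xs → 1 ≤ multiplicity x xs
∈⇒1≤multiplicity {x} (here refl) rewrite ≡ᵇ-refl x = s≤s z≤n
∈⇒1≤multiplicity {x} {y ∷ _} (there x∈) = ≤-trans (∈⇒1≤multiplicity x∈) (m≤n+m _ (indicator (x ≡ᵇ y)))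

1≤multiplicity⇒∈ : ∀ {x} xs → 1 ≤ multiplicity x xs → x ∈ xs
1≤multiplicity⇒∈ {x} (y ∷ xs) p with x ≡ᵇ y in x≡y
... | true rewrite ≡ᵇ≡true⇒≡ {x} {y} x≡y = here refl
... | false = there (1≤multiplicity⇒∈ xs p)

∈-sameMultiplicities : ∀ σ τ {x} → (∀ a → multiplicity a σ ≡ multiplicity a τ) → x ∈ σ → x ∈ τ
∈-sameMultiplicities σ τ {x} same x∈ = 1≤multiplicity⇒∈ τ (≤-trans (∈⇒1≤multiplicity x∈) (≤-reflexive (same x)))

splitAtFirst : ∀ {s} τ → s ∈ τ → ∃ λ τ₁ → ∃ λ τ₂ → τ ≡ τ₁ ++ s ∷ τ₂ × ¬ s ∈ τ₁
splitAtFirst {s} (t ∷ τ) s∈ with s ≟ t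
... | yes refl = [] , τ , refl , λ ()
splitAtFirst {s} (t ∷ τ) (here refl) | no s≢t = contradiction refl s≢t
splitAtFirst {s} (t ∷ τ) (there s∈)  | no s≢t with splitAtFirst τ s∈
... | τ₁ , τ₂ , refl , s∉τ₁ = t ∷ τ₁ , τ₂ , refl , λ { (here refl) → s≢t refl ; (there s∈τ₁) → s∉τ₁ s∈τ₁ }

Inversions⊆⇒Weak : ∀ σ τ → (∀ a → multiplicity a σ ≤ 1) → (∀ a → multiplicity a σ ≡ multiplicity a τ) →
  Inversions⊆ σ τ → Weak σ τ
Inversions⊆⇒Weak []      []      _      _    _   = ε
Inversions⊆⇒Weak []      (t ∷ τ) _      same _   with () ← ∈-sameMultiplicities (t ∷ τ) [] (λ a → sym (same a)) (here refl)
Inversions⊆⇒Weak (s ∷ σ) τ       simple same inv with splitAtFirst τ (∈-sameMultiplicities (s ∷ σ) τ same (here refl))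
... | τ₁ , τ₂ , refl , s∉τ₁ =
  Weak-∷ s (Inversions⊆⇒Weak σ (τ₁ ++ τ₂) simple' same' inv') ◅◅ Weak-moveRight s τ₁ τ₂ (All.tabulate τ₁-above-s)
  where
  s∉σ : ¬ s ∈ σ
  s∉σ s∈σ with simple s
  ... | 1+m≤1 rewrite ≡ᵇ-refl s = <-irrefl refl (≤-trans (s≤s (∈⇒1≤multiplicity s∈σ)) 1+m≤1)
  simple' : ∀ a → multiplicity a σ ≤ 1
  simple' a = ≤-trans (m≤n+m _ (indicator (a ≡ᵇ s))) (simple a)
  same' : ∀ a → multiplicity a σ ≡ multiplicity a (τ₁ ++ τ₂)
  same' a = +-cancelˡ-≡ (indicator (a ≡ᵇ s)) _ _ (begin
    indicator (a ≡ᵇ s) + multiplicity a σ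
      ≡⟨ same a ⟩
    multiplicity a (τ₁ ++ s ∷ τ₂)
      ≡⟨ sumℕ-++ _ τ₁ (s ∷ τ₂) ⟩
    multiplicity a τ₁ + (indicator (a ≡ᵇ s) + multiplicity a τ₂)
      ≡⟨ +-exchange (multiplicity a τ₁) (indicator (a ≡ᵇ s)) (multiplicity a τ₂) ⟩
    indicator (a ≡ᵇ s) + (multiplicity a τ₁ + multiplicity a τ₂)
      ≡⟨ cong (indicator (a ≡ᵇ s) +_) (sym (sumℕ-++ _ τ₁ τ₂)) ⟩
    indicator (a ≡ᵇ s) + multiplicity a (τ₁ ++ τ₂) ∎)
    where open ≡-Reasoning
  inv' : Inversions⊆ σ (τ₁ ++ τ₂)
  inv' a b a<b inv-σ with Before-++⁻ τ₁ (inv a b a<b (later inv-σ))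
  ... | inj₁ inv-τ₁                        = Before-++ˡ τ₂ inv-τ₁
  ... | inj₂ (inj₁ (b∈ , here refl))       = contradiction (Before-∈ʳ inv-σ) s∉σ
  ... | inj₂ (inj₁ (b∈ , there a∈))        = Before-++-across τ₁ b∈ a∈
  ... | inj₂ (inj₂ (first _))              = contradiction (Before-∈ˡ inv-σ) s∉σ
  ... | inj₂ (inj₂ (later inv-τ₂))         = Before-++ʳ τ₁ inv-τ₂
  τ₁-above-s : ∀ {t} → t ∈ τ₁ → s < t
  τ₁-above-s {t} t∈τ₁ with <-cmp t s
  ... | tri≈ _ refl _ = contradiction t∈τ₁ s∉τ₁
  ... | tri> _ _ s<t  = s<t
  ... | tri< t<s _ _  with Before-++⁻ τ₁ (inv t s t<s (first t∈σ))
    where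
    t∈σ : t ∈ σ
    t∈σ with ∈-sameMultiplicities (τ₁ ++ s ∷ τ₂) (s ∷ σ) (λ a → sym (same a)) (∈-++⁺ˡ t∈τ₁)
    ... | here refl = contradiction t<s (<-irrefl refl)
    ... | there t∈  = t∈
  ...   | inj₁ inv-τ₁              = contradiction (Before-∈ˡ inv-τ₁) s∉τ₁
  ...   | inj₂ (inj₁ (s∈τ₁ , _))   = contradiction s∈τ₁ s∉τ₁
  ...   | inj₂ (inj₂ inv-sτ₂)      = contradiction (simple t) (<⇒≱ twice)
    where
    twice : 1 < multiplicity t (s ∷ σ)
    twice = begin-strict
      1                                              ≤⟨ ∈⇒1≤multiplicity t∈τ₁ ⟩
      multiplicity t τ₁                              <⟨ m<m+n _ (∈⇒1≤multiplicity (Before-∈ʳ inv-sτ₂)) ⟩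
      multiplicity t τ₁ + multiplicity t (s ∷ τ₂)    ≡⟨ sumℕ-++ _ τ₁ (s ∷ τ₂) ⟨
      multiplicity t (τ₁ ++ s ∷ τ₂)                  ≡⟨ same t ⟨
      multiplicity t (s ∷ σ)                         ∎
      where open ≤-Reasoning

-- The weak order and grafting

lowerTree-graftR : ∀ A B → lowerTree (size A) (graftR A B) ≡ A
lowerTree-graftR leaf       B = lowerTree-0 B
lowerTree-graftR (node l r) B
  rewrite ≤⇒≤ᵇ≡true (s≤s (m≤m+n (size l) (size r))) | m+n∸m≡n (size l) (size r) = cong (node l) (lowerTree-graftR r B)

upperTree-graftR : ∀ A B → upperTree (size A) (graftR A B) ≡ B
upperTree-graftR leaf       B = upperTree-0 B
upperTree-graftR (node l r) B
  rewrite ≤⇒≤ᵇ≡true (s≤s (m≤m+n (size l) (size r))) | m+n∸m≡n (size l) (size r) = upperTree-graftR r B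

size≤size-graftL : ∀ A l → size A ≤ size (graftL A l)
size≤size-graftL A l = ≤-trans (m≤m+n (size A) (size l)) (≤-reflexive (sym (size-graftL A l)))

suc-size-graftL≰size : ∀ A l → (suc (size (graftL A l)) ≤ᵇ size A) ≡ false
suc-size-graftL≰size A l = >⇒≤ᵇ≡false (s≤s (size≤size-graftL A l))

lowerTree-graftL : ∀ A B → lowerTree (size A) (graftL A B) ≡ A
lowerTree-graftL A leaf       = lowerTree-≥size (size A) A ≤-refl
lowerTree-graftL A (node l r) rewrite suc-size-graftL≰size A l = lowerTree-graftL A l

upperTree-graftL : ∀ A B → upperTree (size A) (graftL A B) ≡ B
upperTree-graftL A leaf       = proj₂ (upperTree≡leaf⇔ (size A) A) ≤-refl
upperTree-graftL A (node l r) rewrite suc-size-graftL≰size A l = cong (λ t → node t r) (upperTree-graftL A l)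

Weak-restrict : ∀ k S T → Weak (wT S) (wT T) →
  Weak (wT (lowerTree k S)) (wT (lowerTree k T)) × Weak (wT (upperTree k S)) (wT (upperTree k T))
Weak-restrict k S T w =
  subst₂ Weak (lettersUpTo-wT k S) (lettersUpTo-wT k T) (Weak-filter (_≤? k) w) ,
  Weak-unshift k (subst₂ Weak (lettersAbove-wT k S) (lettersAbove-wT k T) (Weak-filter (λ z → ¬? (z ≤? k)) w))

Weak-graftR : ∀ A B T → Weak (wT (lowerTree (size A) T)) (wT A) → Weak (wT (upperTree (size A) T)) (wT B) →
  Weak (wT T) (wT (graftR A B))
Weak-graftR A B T wA wB = subst (Weak (wT T)) (sym (wT-graftR A B))
  (subst (Weak (wT T)) (cong₂ _++_ (lettersAbove-wT k T) (lettersUpTo-wT k T)) (Weak-raiseLettersAbove k (wT T))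
   ◅◅ Weak-++ˡ (map (k +_) (wT (upperTree k T))) wA
   ◅◅ Weak-++ʳ (wT A) (Weak-shift k wB))
  where
  k = size A

graftL-inversion : ∀ j A B {a b} → a ≤ j + size A → j + size A < b → Before b a (readW j (graftL A B)) →
  ∃ λ y → j + size A < y × y < b × Before b y (readW j (graftL A B))
graftL-inversion j A leaf       a≤ <b inv = contradiction (All.lookup (readW-upperBound j A) (Before-∈ˡ inv)) (<⇒≱ <b)
graftL-inversion j A (node l r) {a} {b} a≤ <b inv with Before-++⁻ (readW x r) inv
  where x = suc (j + size (graftL A l))
... | inj₁ inv-r = contradiction (All.lookup (readW-lowerBound _ r) (Before-∈ʳ inv-r))
                     (<⇒≱ (s≤s (≤-trans a≤ (≤-trans (+-monoʳ-≤ j (size≤size-graftL A l)) (n≤1+n _)))))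
... | inj₂ (inj₁ (b∈r , _)) = _ , s≤s (+-monoʳ-≤ j (size≤size-graftL A l)) , All.lookup (readW-lowerBound _ r) b∈r ,
                              Before-++-across (readW _ r) b∈r (∈-++⁺ʳ _ (here refl))
... | inj₂ (inj₂ inv-l) with Before-++⁻ (readW j (graftL A l)) inv-l
...   | inj₁ inv-G with graftL-inversion j A l a≤ <b inv-G
...     | y , <y , y<b , inv-y = y , <y , y<b , Before-++ʳ (readW _ r) (Before-++ˡ (_ ∷ []) inv-y)
graftL-inversion j A (node l r) a≤ <b inv | inj₂ (inj₂ _) | inj₂ (inj₁ (_ , here refl)) =
  contradiction a≤ (<⇒≱ (s≤s (+-monoʳ-≤ j (size≤size-graftL A l))))
graftL-inversion j A (node l r) a≤ <b inv | inj₂ (inj₂ _) | inj₂ (inj₂ inv-x) = contradiction inv-x ¬Before-[ _ ]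

readW-avoids-132 : ∀ j T {a y b} → a < y → y < b → Before a b (readW j T) → ¬ Before b y (readW j T)
readW-avoids-132 j (node l r) {a} {y} {b} a<y y<b ab by = split (Before-++⁻ R ab) (Before-++⁻ R by)
  where
  x = suc (j + size l)
  R = readW x r
  L = readW j l
  x<R : ∀ {z} → z ∈ R → x < z
  x<R = All.lookup (readW-lowerBound x r)
  L<x : ∀ {z} → z ∈ L → z < x
  L<x z∈ = s≤s (All.lookup (readW-upperBound j l) z∈)
  Lx≤x : ∀ {z} → z ∈ L ++ x ∷ [] → z ≤ x
  Lx≤x z∈ with ∈-++⁻ L z∈
  ... | inj₁ z∈L        = <⇒≤ (L<x z∈L)
  ... | inj₂ (here refl) = ≤-refl
  splitL : Before a b L ⊎ (a ∈ L × b ∈ x ∷ []) ⊎ Before a b (x ∷ []) →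
           Before b y L ⊎ (b ∈ L × y ∈ x ∷ []) ⊎ Before b y (x ∷ []) → ⊥
  splitL _                                  (inj₂ (inj₂ by-x))          = ¬Before-[ x ] by-x
  splitL (inj₂ (inj₂ ab-x))                 _                           = ¬Before-[ x ] ab-x
  splitL _                                  (inj₂ (inj₁ (b∈L , here refl))) = <⇒≱ y<b (<⇒≤ (L<x b∈L))
  splitL (inj₁ ab-L)                        (inj₁ by-L)                 = readW-avoids-132 j l a<y y<b ab-L by-L
  splitL (inj₂ (inj₁ (_ , here refl)))      (inj₁ by-L)                 = <-irrefl refl (L<x (Before-∈ˡ by-L))
  split : Before a b R ⊎ (a ∈ R × b ∈ L ++ x ∷ []) ⊎ Before a b (L ++ x ∷ []) →
          Before b y R ⊎ (b ∈ R × y ∈ L ++ x ∷ []) ⊎ Before b y (L ++ x ∷ []) → ⊥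
  split (inj₁ ab-R)          (inj₁ by-R)               = readW-avoids-132 x r a<y y<b ab-R by-R
  split (inj₁ ab-R)          (inj₂ (inj₁ (_ , y∈)))    = <⇒≱ (<-trans (x<R (Before-∈ˡ ab-R)) a<y) (Lx≤x y∈)
  split (inj₁ ab-R)          (inj₂ (inj₂ by-L))        = <⇒≱ (x<R (Before-∈ʳ ab-R)) (Lx≤x (Before-∈ˡ by-L))
  split (inj₂ (inj₁ (a∈ , b∈))) _                      = <⇒≱ (<-trans (x<R a∈) (<-trans a<y y<b)) (Lx≤x b∈)
  split (inj₂ (inj₂ ab-L))   (inj₁ by-R)               = <⇒≱ (x<R (Before-∈ˡ by-R)) (Lx≤x (Before-∈ʳ ab-L))
  split (inj₂ (inj₂ ab-L))   (inj₂ (inj₁ (b∈ , _)))    = <⇒≱ (x<R b∈) (Lx≤x (Before-∈ʳ ab-L))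
  split (inj₂ (inj₂ ab-L))   (inj₂ (inj₂ by-L))        = splitL (Before-++⁻ L ab-L) (Before-++⁻ L by-L)

indicator≤1 : ∀ b → indicator b ≤ 1
indicator≤1 true  = ≤-refl
indicator≤1 false = z≤n

Weak⇒size≡ : ∀ S T → Weak (wT S) (wT T) → size S ≡ size T
Weak⇒size≡ S T w = trans (sym (length-readW 0 S)) (trans (sym (Weak-length w)) (length-readW 0 T))

Weak-graftL : ∀ A B T → Weak (wT A) (wT (lowerTree (size A) T)) → Weak (wT B) (wT (upperTree (size A) T)) →
  Weak (wT (graftL A B)) (wT T)
Weak-graftL A B T wA wB = Inversions⊆⇒Weak σ π simple same inversions
  where
  k = size A
  σ = wT (graftL A B)
  π = wT T
  sizes : size (graftL A B) ≡ size T
  sizes = trans (size-graftL A B) (trans (cong₂ _+_ (Weak⇒size≡ A (lowerTree k T) wA) (Weak⇒size≡ B (upperTree k T) wB))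
                                         (size-lowerTree+size-upperTree k T))
  simple : ∀ a → multiplicity a σ ≤ 1
  simple a = ≤-trans (≤-reflexive (wT-isPermutation (graftL A B) a)) (indicator≤1 _)
  same : ∀ a → multiplicity a σ ≡ multiplicity a π
  same a = trans (wT-isPermutation (graftL A B) a)
                 (trans (cong (λ n → indicator (between 0 n a)) sizes) (sym (wT-isPermutation T a)))
  ∈π : ∀ {z} → z ∈ σ → z ∈ π
  ∈π = ∈-sameMultiplicities σ π same
  low : ∀ {a b} → b ≤ k → a < b → Before b a σ → Before b a π
  low {a} {b} b≤k a<b inv =
    Before-filter⁻ (_≤? k) π (subst (Before b a) (sym (lettersUpTo-wT k T))
      (Weak-preservesInversion wA a<b (subst (Before b a) (trans (lettersUpTo-wT k (graftL A B)) (cong wT (lowerTree-graftL A B)))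
        (Before-filter⁺ (_≤? k) σ b≤k (≤-trans (<⇒≤ a<b) b≤k) inv))))
  high : ∀ {a b} → k < a → a < b → Before b a σ → Before b a π
  high {a} {b} k<a a<b inv =
    Before-filter⁻ (λ z → ¬? (z ≤? k)) π (subst (Before b a) (sym (lettersAbove-wT k T))
      (Weak-preservesInversion (Weak-shift k wB) a<b
        (subst (Before b a) (trans (lettersAbove-wT k (graftL A B)) (cong (map (k +_) ∘ wT) (upperTree-graftL A B)))
          (Before-filter⁺ (λ z → ¬? (z ≤? k)) σ (<⇒≱ (<-trans k<a a<b)) (<⇒≱ k<a) inv))))
  inversions : Inversions⊆ σ π
  inversions a b a<b inv with b ≤? k | a ≤? k
  ... | yes b≤k | _       = low b≤k a<b inv
  ... | no  _   | no  a≰k = high (≰⇒> a≰k) a<b inv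
  -- b also precedes a smaller letter y of B; that inversion survives, and wT T avoids 132.
  ... | no  b≰k | yes a≤k with graftL-inversion 0 A B a≤k (≰⇒> b≰k) inv
  ...   | y , k<y , y<b , inv-y with Before-total π (∈π (Before-∈ʳ inv)) (∈π (Before-∈ˡ inv)) (<⇒≢ a<b)
  ...     | inj₂ ba = ba
  ...     | inj₁ ab = contradiction (high k<y y<b inv-y) (readW-avoids-132 0 T (≤-<-trans a≤k k<y) y<b ab)

weakLeq-graftR : ∀ A B T → weakLeq (wT T) (wT (graftR A B)) ≡
  (weakLeq (wT (lowerTree (size A) T)) (wT A) ∧ weakLeq (wT (upperTree (size A) T)) (wT B))
weakLeq-graftR A B T = ≡∧-intro restrict
  (λ e₁ e₂ → weakLeq-complete (Weak-graftR A B T (weakLeq-sound _ _ e₁) (weakLeq-sound _ _ e₂)))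
  where
  k = size A
  restrict : weakLeq (wT T) (wT (graftR A B)) ≡ true →
    weakLeq (wT (lowerTree k T)) (wT A) ≡ true × weakLeq (wT (upperTree k T)) (wT B) ≡ true
  restrict e with Weak-restrict k T (graftR A B) (weakLeq-sound _ _ e)
  ... | wl , wu = weakLeq-complete (subst (Weak _) (cong wT (lowerTree-graftR A B)) wl) ,
                  weakLeq-complete (subst (Weak _) (cong wT (upperTree-graftR A B)) wu)

weakLeq-graftL : ∀ A B T → weakLeq (wT (graftL A B)) (wT T) ≡
  (weakLeq (wT A) (wT (lowerTree (size A) T)) ∧ weakLeq (wT B) (wT (upperTree (size A) T)))
weakLeq-graftL A B T = ≡∧-intro restrict
  (λ e₁ e₂ → weakLeq-complete (Weak-graftL A B T (weakLeq-sound _ _ e₁) (weakLeq-sound _ _ e₂)))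
  where
  k = size A
  restrict : weakLeq (wT (graftL A B)) (wT T) ≡ true →
    weakLeq (wT A) (wT (lowerTree k T)) ≡ true × weakLeq (wT B) (wT (upperTree k T)) ≡ true
  restrict e with Weak-restrict k (graftL A B) T (weakLeq-sound _ _ e)
  ... | wl , wu = weakLeq-complete (subst (λ S → Weak (wT S) _) (lowerTree-graftL A B) wl) ,
                  weakLeq-complete (subst (λ S → Weak (wT S) _) (upperTree-graftL A B) wu)

height : Tree → ℕ
height leaf       = 0
height (node l r) = suc (height l ⊔ height r)

treesOfHeight≤ : ℕ → List Tree
treesOfHeight≤ zero    = leaf ∷ []
treesOfHeight≤ (suc h) = leaf ∷ concatMap (λ l → map (node l) (treesOfHeight≤ h)) (treesOfHeight≤ h)

treesOfSize : ℕ → List Tree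
treesOfSize n = filterᵇ (λ T → size T ≡ᵇ n) (treesOfHeight≤ n)

sumℕ-map : {A B : Set} (f : B → ℕ) (g : A → B) (L : List A) → sumℕ f (map g L) ≡ sumℕ (f ∘ g) L
sumℕ-map f g []      = refl
sumℕ-map f g (x ∷ L) = cong (f (g x) +_) (sumℕ-map f g L)

count-treesOfHeight≤ : ∀ h X → count _≟ᵀ_ X (treesOfHeight≤ h) ≡ indicator (height X ≤ᵇ h)
count-treesOfHeight≤ zero    leaf       = refl
count-treesOfHeight≤ zero    (node _ _) = refl
count-treesOfHeight≤ (suc h) X = trans (cong (indicator (eqTree X leaf) +_) (begin
  count _≟ᵀ_ X (concatMap (λ l → map (node l) trees) trees)
    ≡⟨ sumℕ-concatMap _ (λ l → map (node l) trees) trees ⟩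
  sumℕ (λ l → count _≟ᵀ_ X (map (node l) trees)) trees
    ≡⟨ sumℕ-cong trees (λ {l} _ → sumℕ-map _ (node l) trees) ⟩
  sumℕ (λ l → sumℕ (λ r → indicator (eqTree X (node l r))) trees) trees
    ≡⟨ nodes X ⟩
  (if eqTree X leaf then 0 else indicator (height X ≤ᵇ suc h)) ∎)) (leaf-or-node X)
  where
  open ≡-Reasoning
  trees = treesOfHeight≤ h
  leaf-or-node : ∀ X → indicator (eqTree X leaf) + (if eqTree X leaf then 0 else indicator (height X ≤ᵇ suc h)) ≡
                       indicator (height X ≤ᵇ suc h)
  leaf-or-node leaf       = refl
  leaf-or-node (node _ _) = refl
  nodes : ∀ X → sumℕ (λ l → sumℕ (λ r → indicator (eqTree X (node l r))) trees) trees ≡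
                (if eqTree X leaf then 0 else indicator (height X ≤ᵇ suc h))
  nodes leaf = trans (sumℕ-cong trees (λ _ → sumℕ-zero trees)) (sumℕ-zero trees)
    where
    sumℕ-zero : {A : Set} (L : List A) → sumℕ (λ _ → 0) L ≡ 0
    sumℕ-zero []      = refl
    sumℕ-zero (_ ∷ L) = sumℕ-zero L
  nodes (node a b) = begin
    sumℕ (λ l → sumℕ (λ r → indicator (eqTree a l ∧ eqTree b r)) trees) trees
      ≡⟨ sumℕ-cong trees (λ {l} _ → sumℕ-cong trees (λ {r} _ → indicator-∧ (eqTree a l) (eqTree b r))) ⟩
    sumℕ (λ l → sumℕ (λ r → indicator (eqTree a l) * indicator (eqTree b r)) trees) trees
      ≡⟨ sumℕ-product _ _ trees trees ⟩
    count _≟ᵀ_ a trees * count _≟ᵀ_ b trees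
      ≡⟨ cong₂ _*_ (count-treesOfHeight≤ h a) (count-treesOfHeight≤ h b) ⟩
    indicator (height a ≤ᵇ h) * indicator (height b ≤ᵇ h)
      ≡⟨ sym (indicator-∧ (height a ≤ᵇ h) (height b ≤ᵇ h)) ⟩
    indicator ((height a ≤ᵇ h) ∧ (height b ≤ᵇ h))
      ≡⟨ cong indicator (height-node≤ᵇ (height a) (height b)) ⟩
    indicator (height (node a b) ≤ᵇ suc h) ∎
    where
    height-node≤ᵇ : ∀ m n → ((m ≤ᵇ h) ∧ (n ≤ᵇ h)) ≡ (suc (m ⊔ n) ≤ᵇ suc h)
    height-node≤ᵇ m n with m ≤? h | n ≤? h
    ... | yes m≤h | yes n≤h rewrite ≤⇒≤ᵇ≡true m≤h | ≤⇒≤ᵇ≡true n≤h = sym (≤⇒≤ᵇ≡true (s≤s (⊔-lub m≤h n≤h)))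
    ... | no  m≰h | _       rewrite >⇒≤ᵇ≡false (≰⇒> m≰h) =
      sym (>⇒≤ᵇ≡false (s≤s (<-≤-trans (≰⇒> m≰h) (m≤m⊔n m n))))
    ... | yes m≤h | no n≰h  rewrite ≤⇒≤ᵇ≡true m≤h | >⇒≤ᵇ≡false (≰⇒> n≰h) =
      sym (>⇒≤ᵇ≡false (s≤s (<-≤-trans (≰⇒> n≰h) (m≤n⊔m m n))))

height≤size : ∀ T → height T ≤ size T
height≤size leaf       = z≤n
height≤size (node l r) = s≤s (⊔-lub (≤-trans (height≤size l) (m≤m+n _ _)) (≤-trans (height≤size r) (m≤n+m _ _)))

count-treesOfSize : ∀ n X → count _≟ᵀ_ X (treesOfSize n) ≡ indicator (size X ≡ᵇ n)
count-treesOfSize n X rewrite count-filterᵇ _≟ᵀ_ X (λ T → size T ≡ᵇ n) (treesOfHeight≤ n)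
                            | count-treesOfHeight≤ n X with size X ≡ᵇ n in X≡n
... | false = *-zeroʳ (indicator (height X ≤ᵇ n))
... | true rewrite ≤⇒≤ᵇ≡true (≤-trans (height≤size X) (≤-reflexive (≡ᵇ≡true⇒≡ {size X} {n} X≡n))) = refl

∈-treesOfSize⇒size : ∀ n {T} → T ∈ treesOfSize n → size T ≡ n
∈-treesOfSize⇒size n {T} T∈ = ≡ᵇ⇒≡ (size T) n (proj₂ (∈-filter⁻ (T? ∘ (λ T → size T ≡ᵇ n)) {xs = treesOfHeight≤ n} T∈))

-- An order on trees compatible with grafting

record GraftingOrder : Set₁ where
  field
    _≼_            : Tree → Tree → Bool
    ≼-refl         : ∀ T → (T ≼ T) ≡ true
    ≼⇒size≡        : ∀ S T → (S ≼ T) ≡ true → size S ≡ size T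
    rank           : Tree → ℕ
    ≺⇒rank<        : ∀ S T → (S ≼ T) ≡ true → S ≢ T → rank S < rank T
    graft          : Tree → Tree → Tree
    ≼-graft        : ∀ A B T → (T ≼ graft A B) ≡ ((lowerTree (size A) T ≼ A) ∧ (upperTree (size A) T ≼ B))
    stem           : Tree → Tree
    stem-injective : ∀ {l l'} → stem l ≡ stem l' → l ≡ l'
    size-stem      : ∀ l → size (stem l) ≡ suc (size l)
    stem≢graft     : ∀ l A B → 0 < size A → 0 < size B → stem l ≢ graft A B
    decompose      : ∀ T → T ≡ leaf ⊎ (∃ λ l → T ≡ stem l) ⊎
                       (∃ λ A → ∃ λ B → 0 < size A × 0 < size B × T ≡ graft A B)

leftSubtree rightSubtree : Tree → Tree
leftSubtree  leaf       = leaf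
leftSubtree  (node l _) = l
rightSubtree leaf       = leaf
rightSubtree (node _ r) = r

weakLeq-wT⇒coinversions> : ∀ S T → weakLeq (wT S) (wT T) ≡ true → S ≢ T → coinversions (wT T) < coinversions (wT S)
weakLeq-wT⇒coinversions> S T e S≢T with Weak⇒≡⊎coinversions< (weakLeq-sound _ _ e)
... | inj₁ eq = contradiction (wT-injective eq) S≢T
... | inj₂ lt = lt

0<size-graftR : ∀ A B → 0 < size B → 0 < size (graftR A B)
0<size-graftR A B 0<B = ≤-trans 0<B (≤-trans (m≤n+m (size B) (size A)) (≤-reflexive (sym (size-graftR A B))))

0<size-graftL : ∀ A B → 0 < size A → 0 < size (graftL A B)
0<size-graftL A B 0<A = ≤-trans 0<A (≤-trans (m≤m+n (size A) (size B)) (≤-reflexive (sym (size-graftL A B))))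

H-order : GraftingOrder
H-order = record
  { _≼_            = λ S T → weakLeq (wT S) (wT T)
  ; ≼-refl         = λ T → weakLeq-complete {wT T} ε
  ; ≼⇒size≡        = λ S T e → Weak⇒size≡ S T (weakLeq-sound _ _ e)
  -- Coinversions decrease up the weak order and are bounded by size².
  ; rank           = λ T → size T * size T ∸ coinversions (wT T)
  ; ≺⇒rank<        = λ S T e S≢T → subst (λ n → size S * size S ∸ coinversions (wT S) < n * n ∸ coinversions (wT T))
                       (Weak⇒size≡ S T (weakLeq-sound _ _ e))
                       (∸-monoʳ-< (weakLeq-wT⇒coinversions> S T e S≢T) (coinversions-wT≤ S))
  ; graft          = graftR
  ; ≼-graft        = weakLeq-graftR
  ; stem           = λ l → node l leaf
  ; stem-injective = λ { refl → refl }
  ; size-stem      = λ l → cong suc (ℕ.+-identityʳ (size l))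
  ; stem≢graft     = stem≢graftR
  ; decompose      = decompose
  }
  where
  coinversions-wT≤ : ∀ T → coinversions (wT T) ≤ size T * size T
  coinversions-wT≤ T = subst (λ n → coinversions (wT T) ≤ n * n) (length-readW 0 T) (coinversions≤length² (wT T))
  stem≢graftR : ∀ l A B → 0 < size A → 0 < size B → node l leaf ≢ graftR A B
  stem≢graftR l (node a b) B _ 0<B eq =
    <-irrefl (cong size (cong rightSubtree eq)) (0<size-graftR b B 0<B)
  decompose : ∀ T → T ≡ leaf ⊎ (∃ λ l → T ≡ node l leaf) ⊎
                (∃ λ A → ∃ λ B → 0 < size A × 0 < size B × T ≡ graftR A B)
  decompose leaf                = inj₁ refl
  decompose (node l leaf)       = inj₂ (inj₁ (l , refl))
  decompose (node l (node a b)) = inj₂ (inj₂ (node l leaf , node a b , s≤s z≤n , s≤s z≤n , refl))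

E-order : GraftingOrder
E-order = record
  { _≼_            = λ S T → weakLeq (wT T) (wT S)
  ; ≼-refl         = λ T → weakLeq-complete {wT T} ε
  ; ≼⇒size≡        = λ S T e → sym (Weak⇒size≡ T S (weakLeq-sound _ _ e))
  ; rank           = coinversions ∘ wT
  ; ≺⇒rank<        = λ S T e S≢T → weakLeq-wT⇒coinversions> T S e (S≢T ∘ sym)
  ; graft          = graftL
  ; ≼-graft        = weakLeq-graftL
  ; stem           = node leaf
  ; stem-injective = λ { refl → refl }
  ; size-stem      = λ l → refl
  ; stem≢graft     = stem≢graftL
  ; decompose      = decompose
  }
  where
  stem≢graftL : ∀ l A B → 0 < size A → 0 < size B → node leaf l ≢ graftL A B
  stem≢graftL l A (node a b) 0<A _ eq =
    <-irrefl (cong size (cong leftSubtree eq)) (0<size-graftL A a 0<A)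
  decompose : ∀ T → T ≡ leaf ⊎ (∃ λ l → T ≡ node leaf l) ⊎
                (∃ λ A → ∃ λ B → 0 < size A × 0 < size B × T ≡ graftL A B)
  decompose leaf                = inj₁ refl
  decompose (node leaf r)       = inj₂ (inj₁ (r , refl))
  decompose (node (node a b) r) = inj₂ (inj₂ (node a b , node leaf r , s≤s z≤n , s≤s z≤n , refl))

module Sums {c ℓ : Level} (R : CommutativeRing c ℓ) where
  open CommutativeRing R
    renaming (_+_ to _⊕_; _*_ to _⊗_; refl to ≈-refl; sym to ≈-sym; trans to ≈-trans; reflexive to ≈-reflexive; setoid to ≈-setoid)
  open OverRing R using (sumL; fromℕ; δ)
  open import Relation.Binary.Reasoning.Setoid ≈-setoid
  open import Algebra.Properties.Ring ring using (-0#≈0#; -‿+-comm)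
  open import Algebra.Properties.CommutativeSemigroup +-commutativeSemigroup using (interchange)
  open import Algebra.Properties.CommutativeSemigroup *-commutativeSemigroup using (x∙yz≈y∙xz)

  ∑ : ∀ {a} {A : Set a} → List A → (A → Carrier) → Carrier
  ∑ L f = sumL (map f L)

  ∑-cong : ∀ {a} {A : Set a} {f g : A → Carrier} (L : List A) → (∀ {x} → x ∈ L → f x ≈ g x) → ∑ L f ≈ ∑ L g
  ∑-cong []      f≈g = ≈-refl
  ∑-cong (x ∷ L) f≈g = +-cong (f≈g (here refl)) (∑-cong L (f≈g ∘ there))

  ∑-zero : ∀ {a} {A : Set a} {f : A → Carrier} (L : List A) → (∀ {x} → x ∈ L → f x ≈ 0#) → ∑ L f ≈ 0#
  ∑-zero []      f≈0 = ≈-refl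
  ∑-zero (x ∷ L) f≈0 = ≈-trans (+-cong (f≈0 (here refl)) (∑-zero L (f≈0 ∘ there))) (+-identityˡ 0#)

  ∑-*ˡ : ∀ {a} {A : Set a} (y : Carrier) (f : A → Carrier) (L : List A) → y ⊗ ∑ L f ≈ ∑ L (λ x → y ⊗ f x)
  ∑-*ˡ y f []      = zeroʳ y
  ∑-*ˡ y f (x ∷ L) = ≈-trans (distribˡ y (f x) (∑ L f)) (+-congˡ (∑-*ˡ y f L))

  ∑-*ʳ : ∀ {a} {A : Set a} (y : Carrier) (f : A → Carrier) (L : List A) → ∑ L f ⊗ y ≈ ∑ L (λ x → f x ⊗ y)
  ∑-*ʳ y f L = ≈-trans (*-comm _ y) (≈-trans (∑-*ˡ y f L) (∑-cong L (λ {x} _ → *-comm y (f x))))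

  ∑-+ : ∀ {a} {A : Set a} (f g : A → Carrier) (L : List A) → ∑ L (λ x → f x ⊕ g x) ≈ ∑ L f ⊕ ∑ L g
  ∑-+ f g []      = ≈-sym (+-identityˡ 0#)
  ∑-+ f g (x ∷ L) = ≈-trans (+-congˡ (∑-+ f g L)) (interchange (f x) (g x) (∑ L f) (∑ L g))

  ∑-neg : ∀ {a} {A : Set a} (f : A → Carrier) (L : List A) → ∑ L (λ x → - f x) ≈ - ∑ L f
  ∑-neg f []      = ≈-sym -0#≈0#
  ∑-neg f (x ∷ L) = ≈-trans (+-congˡ (∑-neg f L)) (-‿+-comm (f x) (∑ L f))

  ∑-swap : ∀ {a b} {A : Set a} {B : Set b} (f : A → B → Carrier) (L : List A) (M : List B) →
    ∑ L (λ x → ∑ M (f x)) ≈ ∑ M (λ y → ∑ L (λ x → f x y))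
  ∑-swap f []      M = ≈-sym (∑-zero M (λ _ → ≈-refl))
  ∑-swap f (x ∷ L) M = ≈-trans (+-congˡ (∑-swap f L M)) (≈-sym (∑-+ (f x) (λ y → ∑ L (λ x → f x y)) M))

  ∑-⊗-swap : ∀ {a b} {A : Set a} {B : Set b} (f : A → Carrier) (w : B → Carrier) (g : A → B → Carrier)
    (L : List A) (M : List B) → ∑ L (λ x → f x ⊗ ∑ M (λ y → w y ⊗ g x y)) ≈ ∑ M (λ y → w y ⊗ ∑ L (λ x → f x ⊗ g x y))
  ∑-⊗-swap f w g L M = begin
    ∑ L (λ x → f x ⊗ ∑ M (λ y → w y ⊗ g x y))       ≈⟨ ∑-cong L (λ {x} _ → ∑-*ˡ (f x) _ M) ⟩
    ∑ L (λ x → ∑ M (λ y → f x ⊗ (w y ⊗ g x y)))     ≈⟨ ∑-swap (λ x y → f x ⊗ (w y ⊗ g x y)) L M ⟩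
    ∑ M (λ y → ∑ L (λ x → f x ⊗ (w y ⊗ g x y)))     ≈⟨ ∑-cong M (λ {y} _ → ∑-cong L (λ {x} _ → x∙yz≈y∙xz (f x) (w y) (g x y))) ⟩
    ∑ M (λ y → ∑ L (λ x → w y ⊗ (f x ⊗ g x y)))     ≈⟨ ∑-cong M (λ {y} _ → ∑-*ˡ (w y) _ L) ⟨
    ∑ M (λ y → w y ⊗ ∑ L (λ x → f x ⊗ g x y))       ∎

  ι : Bool → Carrier
  ι b = if b then 1# else 0#

  fromℕ-indicator : ∀ b → fromℕ (indicator b) ≈ ι b
  fromℕ-indicator true  = +-identityʳ 1#
  fromℕ-indicator false = ≈-refl

  ι-∧ : ∀ a b → ι (a ∧ b) ≈ ι a ⊗ ι b
  ι-∧ true  b = ≈-sym (*-identityˡ (ι b))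
  ι-∧ false b = ≈-sym (zeroˡ (ι b))

  if≈*ι : ∀ b x → (if b then x else 0#) ≈ x ⊗ ι b
  if≈*ι true  x = ≈-sym (*-identityʳ x)
  if≈*ι false x = ≈-sym (zeroʳ x)

  ∑-pick : ∀ {A : Set} (_≟_ : DecidableEquality A) x (h : A → Carrier) L →
    ∑ L (λ u → ι (does (x ≟ u)) ⊗ h u) ≈ fromℕ (count _≟_ x L) ⊗ h x
  ∑-pick _≟_ x h []      = ≈-sym (zeroˡ (h x))
  ∑-pick _≟_ x h (u ∷ L) with x ≟ u
  ... | yes refl = begin
    1# ⊗ h x ⊕ ∑ L (λ u → ι (does (x ≟ u)) ⊗ h u)   ≈⟨ +-congˡ (∑-pick _≟_ x h L) ⟩
    1# ⊗ h x ⊕ fromℕ (count _≟_ x L) ⊗ h x           ≈⟨ distribʳ (h x) 1# _ ⟨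
    (1# ⊕ fromℕ (count _≟_ x L)) ⊗ h x               ∎
  ... | no _ = ≈-trans (+-cong (zeroˡ (h u)) (∑-pick _≟_ x h L)) (+-identityˡ _)

  ∑-treesOfSize-pick : ∀ n X (h : Tree → Carrier) → ∑ (treesOfSize n) (λ T → δ X T ⊗ h T) ≈ ι (size X ≡ᵇ n) ⊗ h X
  ∑-treesOfSize-pick n X h = ≈-trans (∑-pick _≟ᵀ_ X h (treesOfSize n))
    (*-congʳ (≈-trans (≈-reflexive (cong fromℕ (count-treesOfSize n X))) (fromℕ-indicator _)))

-- Primitive elements of PBT*

module Primitives (O : GraftingOrder) {c ℓ : Level} (R : CommutativeRing c ℓ) where
  open GraftingOrder O
  open CommutativeRing R
    renaming (_+_ to _⊕_; _*_ to _⊗_; refl to ≈-refl; sym to ≈-sym; trans to ≈-trans; reflexive to ≈-reflexive; setoid to ≈-setoid)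
  open OverRing R
  open Sums R
  open import Relation.Binary.Reasoning.Setoid ≈-setoid
  open import Algebra.Properties.Ring ring using (x+x≈x⇒x≈0; x∙y⁻¹≈ε⇒x≈y; -‿distribʳ-*)
  open import Algebra.Properties.CommutativeSemigroup *-commutativeSemigroup using (x∙yz≈y∙zx; x∙yz≈y∙xz)

  -- ⟨x , Σ_(S ≼ T) P_S⟩: pairH for H-order, pairE for E-order.
  pair : Elem → Tree → Carrier
  pair x T = ∑ x (λ p → if proj₂ p ≼ T then proj₁ p else 0#)

  IsDual : (Tree → Elem) → Set ℓ
  IsDual V = ∀ T T' → pair (V T) T' ≈ δ T T'

  -- The pairing of Σ_S f S · Q_S with H_T (resp. E_T).
  ζ : (Tree → Carrier) → Tree → Carrier
  ζ f T = ∑ (treesOfSize (size T)) (λ S → ι (S ≼ T) ⊗ f S)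

  ζ-cong : ∀ {f g} T → (∀ S → size S ≡ size T → f S ≈ g S) → ζ f T ≈ ζ g T
  ζ-cong T f≈g = ∑-cong (treesOfSize (size T)) (λ {S} S∈ → *-congˡ (f≈g S (∈-treesOfSize⇒size (size T) S∈)))

  ζ-⊗-swap : ∀ {b} {B : Set b} (w : B → Carrier) (g : Tree → B → Carrier) (M : List B) T →
    ζ (λ S → ∑ M (λ y → w y ⊗ g S y)) T ≈ ∑ M (λ y → w y ⊗ ζ (λ S → g S y) T)
  ζ-⊗-swap w g M T = ∑-⊗-swap (λ S → ι (S ≼ T)) w g (treesOfSize (size T)) M

  ι-≼-size≢ : ∀ S T → size S ≢ size T → ι (S ≼ T) ≈ 0#
  ι-≼-size≢ S T S≢T with S ≼ T in S≼T
  ... | true  = contradiction (≼⇒size≡ S T S≼T) S≢T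
  ... | false = ≈-refl

  ∑-treesOfSize : ∀ (z : Elem) n (g : Tree → Carrier) → (∀ T → size T ≢ n → g T ≈ 0#) →
    ∑ z (λ p → proj₁ p ⊗ g (proj₂ p)) ≈ ∑ (treesOfSize n) (λ T → g T ⊗ coeff z T)
  ∑-treesOfSize z n g g≈0 = ≈-sym (begin
    ∑ (treesOfSize n) (λ T → g T ⊗ coeff z T)
      ≈⟨ ∑-cong (treesOfSize n) (λ {T} _ → ∑-*ˡ (g T) (λ p → proj₁ p ⊗ δ (proj₂ p) T) z) ⟩
    ∑ (treesOfSize n) (λ T → ∑ z (λ p → g T ⊗ (proj₁ p ⊗ δ (proj₂ p) T)))
      ≈⟨ ∑-swap (λ T p → g T ⊗ (proj₁ p ⊗ δ (proj₂ p) T)) (treesOfSize n) z ⟩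
    ∑ z (λ p → ∑ (treesOfSize n) (λ T → g T ⊗ (proj₁ p ⊗ δ (proj₂ p) T)))
      ≈⟨ ∑-cong z (λ {p} _ → ≈-trans (∑-cong (treesOfSize n) (λ {T} _ → x∙yz≈y∙zx (g T) (proj₁ p) (δ (proj₂ p) T)))
                                     (≈-sym (∑-*ˡ (proj₁ p) (λ T → δ (proj₂ p) T ⊗ g T) (treesOfSize n)))) ⟩
    ∑ z (λ p → proj₁ p ⊗ ∑ (treesOfSize n) (λ T → δ (proj₂ p) T ⊗ g T))
      ≈⟨ ∑-cong z (λ {p} _ → *-congˡ (≈-trans (∑-treesOfSize-pick n (proj₂ p) g) (select (proj₂ p)))) ⟩
    ∑ z (λ p → proj₁ p ⊗ g (proj₂ p)) ∎)
    where
    select : ∀ X → ι (size X ≡ᵇ n) ⊗ g X ≈ g X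
    select X with size X ≡ᵇ n in X≡n
    ... | true  = *-identityˡ (g X)
    ... | false = ≈-trans (zeroˡ (g X)) (≈-sym (g≈0 X (does-false⇒ (size X ≟ n) X≡n)))

  pair≈ζ-coeff : ∀ z T → pair z T ≈ ζ (coeff z) T
  pair≈ζ-coeff z T = ≈-trans (∑-cong z (λ {p} _ → if≈*ι (proj₂ p ≼ T) (proj₁ p)))
    (∑-treesOfSize z (size T) (λ S → ι (S ≼ T)) (λ S → ι-≼-size≢ S T))

  ζ-δ : ∀ C A → ζ (δ C) A ≈ ι (C ≼ A)
  ζ-δ C A = begin
    ∑ (treesOfSize (size A)) (λ A' → ι (A' ≼ A) ⊗ δ C A')   ≈⟨ ∑-cong (treesOfSize (size A)) (λ {A'} _ → *-comm _ (δ C A')) ⟩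
    ∑ (treesOfSize (size A)) (λ A' → δ C A' ⊗ ι (A' ≼ A))   ≈⟨ ∑-treesOfSize-pick (size A) C (λ A' → ι (A' ≼ A)) ⟩
    ι (size C ≡ᵇ size A) ⊗ ι (C ≼ A)                        ≈⟨ select ⟩
    ι (C ≼ A)                                               ∎
    where
    select : ι (size C ≡ᵇ size A) ⊗ ι (C ≼ A) ≈ ι (C ≼ A)
    select with C ≼ A in C≼A
    ... | false = zeroʳ _
    ... | true rewrite ≡⇒≡ᵇ≡true (≼⇒size≡ C A C≼A) = *-identityˡ 1#

  -- (H_T) is unitriangular with respect to (P_T), so ζ is injective on each degree.
  ζ-injective : ∀ k (h : Tree → Carrier) → (∀ A → size A ≡ k → ζ h A ≈ 0#) → ∀ A → size A ≡ k → h A ≈ 0#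
  ζ-injective k h ζh≈0 A sizeA = <-rec P step (rank A) A refl sizeA
    where
    P : ℕ → Set ℓ
    P n = ∀ A → rank A ≡ n → size A ≡ k → h A ≈ 0#
    step : ∀ n → (∀ {m} → m < n → P m) → P n
    step _ IH A refl sizeA = begin
      h A                                                      ≈⟨ *-identityˡ (h A) ⟨
      1# ⊗ h A                                                 ≈⟨ *-congʳ (≈-reflexive (cong ι (sym (≡ᵇ-refl (size A))))) ⟩
      ι (size A ≡ᵇ size A) ⊗ h A                               ≈⟨ ∑-treesOfSize-pick (size A) A h ⟨
      ∑ (treesOfSize (size A)) (λ A' → δ A A' ⊗ h A')          ≈⟨ ∑-cong _ (diagonal ∘ ∈-treesOfSize⇒size (size A)) ⟩
      ζ h A                                                    ≈⟨ ζh≈0 A sizeA ⟩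
      0#                                                       ∎
      where
      diagonal : ∀ {A'} → size A' ≡ size A → δ A A' ⊗ h A' ≈ ι (A' ≼ A) ⊗ h A'
      diagonal {A'} sizeA' with eqTree A A' in A≡A'
      ... | true rewrite does-true⇒ (A ≟ᵀ A') A≡A' | ≼-refl A' = ≈-refl
      ... | false with A' ≼ A in A'≼A
      ...   | false = ≈-refl
      ...   | true  = ≈-trans (zeroˡ (h A')) (≈-sym (≈-trans (*-congˡ (IH A'≺A A' refl (trans sizeA' sizeA))) (zeroʳ 1#)))
        where
        A'≺A = ≺⇒rank< A' A A'≼A (does-false⇒ (A ≟ᵀ A') A≡A' ∘ sym)

  Δcoeff-leafˡ : ∀ z B → Δcoeff z leaf B ≈ coeff z B
  Δcoeff-leafˡ z B = ∑-cong z (λ {p} _ → *-congˡ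
    (≈-trans (≈-reflexive (cong fromℕ (structConst-leafˡ B (proj₂ p)))) (fromℕ-indicator _)))

  Δcoeff-leafʳ : ∀ z A → Δcoeff z A leaf ≈ coeff z A
  Δcoeff-leafʳ z A = ∑-cong z (λ {p} _ → *-congˡ
    (≈-trans (≈-reflexive (cong fromℕ (structConst-leafʳ A (proj₂ p)))) (fromℕ-indicator _)))

  0⊗+0⊗≈0 : ∀ a b → (0# ⊗ a) ⊕ (0# ⊗ b) ≈ 0#
  0⊗+0⊗≈0 a b = ≈-trans (+-cong (zeroˡ a) (zeroˡ b)) (+-identityʳ 0#)

  primitive⇒ : ∀ x → Primitive x →
    coeff x leaf ≈ 0# × (∀ A B → 0 < size A → 0 < size B → Δcoeff x A B ≈ 0#)
  primitive⇒ x prim = x+x≈x⇒x≈0 (coeff x leaf) doubled , mixed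
    where
    doubled : coeff x leaf ⊕ coeff x leaf ≈ coeff x leaf
    doubled = begin
      coeff x leaf ⊕ coeff x leaf               ≈⟨ +-cong (*-identityˡ _) (*-identityˡ _) ⟨
      1# ⊗ coeff x leaf ⊕ 1# ⊗ coeff x leaf     ≈⟨ prim leaf leaf ⟨
      Δcoeff x leaf leaf                        ≈⟨ Δcoeff-leafˡ x leaf ⟩
      coeff x leaf                              ∎
    mixed : ∀ A B → 0 < size A → 0 < size B → Δcoeff x A B ≈ 0#
    mixed A@(node _ _) B@(node _ _) _ _ = ≈-trans (prim A B) (0⊗+0⊗≈0 _ _)

  ⇒primitive : ∀ x → coeff x leaf ≈ 0# → (∀ A B → 0 < size A → 0 < size B → Δcoeff x A B ≈ 0#) → Primitive x
  ⇒primitive x c≈0 mixed leaf       leaf       = ≈-trans (Δcoeff-leafˡ x leaf)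
    (≈-trans c≈0 (≈-sym (≈-trans (+-cong (*-identityˡ _) (*-identityˡ _)) (≈-trans (+-cong c≈0 c≈0) (+-identityʳ 0#)))))
  ⇒primitive x c≈0 mixed leaf       (node _ _) =
    ≈-trans (Δcoeff-leafˡ x _) (≈-sym (≈-trans (+-cong (zeroˡ _) (*-identityˡ _)) (+-identityˡ _)))
  ⇒primitive x c≈0 mixed (node _ _) leaf       =
    ≈-trans (Δcoeff-leafʳ x _) (≈-sym (≈-trans (+-cong (*-identityˡ _) (zeroˡ _)) (+-identityʳ _)))
  ⇒primitive x c≈0 mixed A@(node _ _) B@(node _ _) = ≈-trans (mixed A B (s≤s z≤n) (s≤s z≤n)) (≈-sym (0⊗+0⊗≈0 _ _))

  -- The coefficientwise form of H_A · H_B = H_(graft A B).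
  graft-product : ∀ A B T → ζ (λ A' → ζ (λ B' → fromℕ (structConst A' B' T)) B) A ≈ ι (T ≼ graft A B)
  graft-product A B T = begin
    ζ (λ A' → ζ (λ B' → fromℕ (structConst A' B' T)) B) A
      ≈⟨ ζ-cong A (λ A' sizeA' → ζ-cong B (λ B' _ → factor A' B' sizeA')) ⟩
    ζ (λ A' → ζ (λ B' → δ C A' ⊗ δ D B') B) A
      ≈⟨ ζ-cong A (λ A' _ → ≈-trans (∑-cong (treesOfSize (size B)) (λ {B'} _ → x∙yz≈y∙xz (ι (B' ≼ B)) (δ C A') (δ D B')))
                                     (≈-sym (∑-*ˡ (δ C A') _ (treesOfSize (size B))))) ⟩
    ζ (λ A' → δ C A' ⊗ ζ (δ D) B) A
      ≈⟨ ζ-cong A (λ A' _ → *-congˡ (ζ-δ D B)) ⟩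
    ζ (λ A' → δ C A' ⊗ ι (D ≼ B)) A
      ≈⟨ ∑-cong (treesOfSize (size A)) (λ {A'} _ → ≈-sym (*-assoc (ι (A' ≼ A)) (δ C A') (ι (D ≼ B)))) ⟩
    ∑ (treesOfSize (size A)) (λ A' → (ι (A' ≼ A) ⊗ δ C A') ⊗ ι (D ≼ B))
      ≈⟨ ∑-*ʳ (ι (D ≼ B)) (λ A' → ι (A' ≼ A) ⊗ δ C A') (treesOfSize (size A)) ⟨
    ζ (δ C) A ⊗ ι (D ≼ B)
      ≈⟨ *-congʳ (ζ-δ C A) ⟩
    ι (C ≼ A) ⊗ ι (D ≼ B)
      ≈⟨ ι-∧ (C ≼ A) (D ≼ B) ⟨
    ι ((C ≼ A) ∧ (D ≼ B))
      ≈⟨ ≈-reflexive (cong ι (≼-graft A B T)) ⟨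
    ι (T ≼ graft A B) ∎
    where
    C = lowerTree (size A) T
    D = upperTree (size A) T
    factor : ∀ A' B' → size A' ≡ size A → fromℕ (structConst A' B' T) ≈ δ C A' ⊗ δ D B'
    factor A' B' sizeA' rewrite structConst-formula A' B' T | sizeA' =
      ≈-trans (fromℕ-indicator _) (ι-∧ (eqTree C A') (eqTree D B'))

  pair-graft : ∀ z A B → ζ (λ A' → ζ (λ B' → Δcoeff z A' B') B) A ≈ pair z (graft A B)
  pair-graft z A B = begin
    ζ (λ A' → ζ (λ B' → Δcoeff z A' B') B) A
      ≈⟨ ζ-cong A (λ A' _ → ζ-⊗-swap proj₁ (λ B' p → fromℕ (structConst A' B' (proj₂ p))) z B) ⟩
    ζ (λ A' → ∑ z (λ p → proj₁ p ⊗ ζ (λ B' → fromℕ (structConst A' B' (proj₂ p))) B)) A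
      ≈⟨ ζ-⊗-swap proj₁ (λ A' p → ζ (λ B' → fromℕ (structConst A' B' (proj₂ p))) B) z A ⟩
    ∑ z (λ p → proj₁ p ⊗ ζ (λ A' → ζ (λ B' → fromℕ (structConst A' B' (proj₂ p))) B) A)
      ≈⟨ ∑-cong z (λ {p} _ → *-congˡ (graft-product A B (proj₂ p))) ⟩
    ∑ z (λ p → proj₁ p ⊗ ι (proj₂ p ≼ graft A B))
      ≈⟨ ∑-cong z (λ {p} _ → if≈*ι (proj₂ p ≼ graft A B) (proj₁ p)) ⟨
    pair z (graft A B) ∎

  combination : List (Carrier × Tree) → (Tree → Elem) → Tree → Carrier
  combination L V T = ∑ L (λ q → proj₁ q ⊗ coeff (V (proj₂ q)) T)

  ζ-combination : ∀ V → IsDual V → ∀ L T → ζ (combination L V) T ≈ ∑ L (λ q → proj₁ q ⊗ δ (proj₂ q) T)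
  ζ-combination V dual L T = ≈-trans (ζ-⊗-swap proj₁ (λ S q → coeff (V (proj₂ q)) S) L T)
    (∑-cong L (λ {q} _ → *-congˡ (≈-trans (≈-sym (pair≈ζ-coeff (V (proj₂ q)) T)) (dual (proj₂ q) T))))

  ζ-difference : ∀ f g T → ζ (λ S → f S ⊕ (- g S)) T ≈ ζ f T ⊕ (- ζ g T)
  ζ-difference f g T = begin
    ∑ trees (λ S → ι (S ≼ T) ⊗ (f S ⊕ (- g S)))
      ≈⟨ ∑-cong trees (λ {S} _ → ≈-trans (distribˡ _ _ _) (+-congˡ (≈-sym (-‿distribʳ-* (ι (S ≼ T)) (g S))))) ⟩
    ∑ trees (λ S → ι (S ≼ T) ⊗ f S ⊕ (- (ι (S ≼ T) ⊗ g S)))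
      ≈⟨ ∑-+ _ _ trees ⟩
    ζ f T ⊕ ∑ trees (λ S → - (ι (S ≼ T) ⊗ g S))
      ≈⟨ +-congˡ (∑-neg _ trees) ⟩
    ζ f T ⊕ (- ζ g T) ∎
    where
    trees = treesOfSize (size T)

  pair-leaf : ∀ z → pair z leaf ≈ coeff z leaf
  pair-leaf z = ≈-trans (pair≈ζ-coeff z leaf)
    (≈-trans (+-identityʳ _) (≈-trans (*-congʳ (≈-reflexive (cong ι (≼-refl leaf)))) (*-identityˡ _)))

  IsStem : Tree → Set
  IsStem T = ∃ λ l → T ≡ stem l

  VanishesOffStems : Elem → Set ℓ
  VanishesOffStems x = ∀ T → (∀ l → stem l ≢ T) → pair x T ≈ 0#

  δ-stem : ∀ l T → (∀ l' → stem l' ≢ T) → δ (stem l) T ≈ 0#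
  δ-stem l T ¬stem rewrite dec-false (stem l ≟ᵀ T) (¬stem l) = ≈-refl

  stem≢leaf : ∀ l → stem l ≢ leaf
  stem≢leaf l eq with () ← trans (sym (size-stem l)) (cong size eq)

  ∈-treesOfSize-positive : ∀ {n A'} → 0 < n → A' ∈ treesOfSize n → 0 < size A'
  ∈-treesOfSize-positive {n} 0<n A'∈ = subst (0 <_) (sym (∈-treesOfSize⇒size n A'∈)) 0<n

  mixed≈0⇒pair-graft≈0 : ∀ x → (∀ A B → 0 < size A → 0 < size B → Δcoeff x A B ≈ 0#) →
    ∀ A B → 0 < size A → 0 < size B → pair x (graft A B) ≈ 0#
  mixed≈0⇒pair-graft≈0 x mixed A B 0<A 0<B =
    ≈-trans (≈-sym (pair-graft x A B)) (∑-zero (treesOfSize (size A)) λ A'∈ →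
      ≈-trans (*-congˡ (∑-zero (treesOfSize (size B)) λ B'∈ →
        ≈-trans (*-congˡ (mixed _ _ (∈-treesOfSize-positive 0<A A'∈) (∈-treesOfSize-positive 0<B B'∈))) (zeroʳ _)))
      (zeroʳ _))

  pair-graft≈0⇒mixed≈0 : ∀ x → (∀ A B → 0 < size A → 0 < size B → pair x (graft A B) ≈ 0#) →
    ∀ A B → 0 < size A → 0 < size B → Δcoeff x A B ≈ 0#
  pair-graft≈0⇒mixed≈0 x pair≈0 A B 0<A 0<B =
    ζ-injective (size B) (Δcoeff x A) (λ B₁ sizeB₁ → ζΔ≈0 B₁ sizeB₁ A refl) B refl
    where
    ζΔ≈0 : ∀ B₁ → size B₁ ≡ size B → ∀ A' → size A' ≡ size A → ζ (Δcoeff x A') B₁ ≈ 0#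
    ζΔ≈0 B₁ sizeB₁ = ζ-injective (size A) (λ A' → ζ (Δcoeff x A') B₁) λ A₁ sizeA₁ →
      ≈-trans (pair-graft x A₁ B₁) (pair≈0 A₁ B₁ (subst (0 <_) (sym sizeA₁) 0<A) (subst (0 <_) (sym sizeB₁) 0<B))

  primitive⇒vanishesOffStems : ∀ x → Primitive x → VanishesOffStems x
  primitive⇒vanishesOffStems x prim T ¬stem with decompose T
  ... | inj₁ refl                          = ≈-trans (pair-leaf x) (proj₁ (primitive⇒ x prim))
  ... | inj₂ (inj₁ (l , refl))             = contradiction refl (¬stem l)
  ... | inj₂ (inj₂ (A , B , 0<A , 0<B , refl)) =
    mixed≈0⇒pair-graft≈0 x (proj₂ (primitive⇒ x prim)) A B 0<A 0<B

  vanishesOffStems⇒primitive : ∀ x → VanishesOffStems x → Primitive x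
  vanishesOffStems⇒primitive x offStems =
    ⇒primitive x (≈-trans (≈-sym (pair-leaf x)) (offStems leaf stem≢leaf))
      (pair-graft≈0⇒mixed≈0 x (λ A B 0<A 0<B → offStems (graft A B) (λ l → stem≢graft l A B 0<A 0<B)))

  span⇒vanishesOffStems : ∀ V → IsDual V → ∀ x → InSpan IsStem V x → VanishesOffStems x
  span⇒vanishesOffStems V dual x (L , stems , x≈L) T ¬stem = begin
    pair x T                                   ≈⟨ pair≈ζ-coeff x T ⟩
    ζ (coeff x) T                              ≈⟨ ζ-cong T (λ S _ → x≈L S) ⟩
    ζ (combination L V) T                      ≈⟨ ζ-combination V dual L T ⟩
    ∑ L (λ q → proj₁ q ⊗ δ (proj₂ q) T)        ≈⟨ ∑-zero L (λ q∈ → term (All.lookup stems q∈)) ⟩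
    0#                                         ∎
    where
    term : ∀ {q} → IsStem (proj₂ q) → proj₁ q ⊗ δ (proj₂ q) T ≈ 0#
    term {a , _} (l , refl) = ≈-trans (*-congˡ (δ-stem l T ¬stem)) (zeroʳ a)

  pairings⇒span : ∀ V → IsDual V → ∀ x L → (∀ T → ∑ L (λ q → proj₁ q ⊗ δ (proj₂ q) T) ≈ pair x T) →
    ∀ T → coeff x T ≈ combination L V T
  pairings⇒span V dual x L pairings T = x∙y⁻¹≈ε⇒x≈y _ _
    (ζ-injective (size T) (λ S → coeff x S ⊕ (- combination L V S)) (λ A _ → difference≈0 A) T refl)
    where
    difference≈0 : ∀ A → ζ (λ S → coeff x S ⊕ (- combination L V S)) A ≈ 0#
    difference≈0 A = begin
      ζ (λ S → coeff x S ⊕ (- combination L V S)) A   ≈⟨ ζ-difference (coeff x) (combination L V) A ⟩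
      ζ (coeff x) A ⊕ (- ζ (combination L V) A)       ≈⟨ +-cong (≈-sym (pair≈ζ-coeff x A))
                                                               (-‿cong (≈-trans (ζ-combination V dual L A) (pairings A))) ⟩
      pair x A ⊕ (- pair x A)                         ≈⟨ -‿inverseʳ (pair x A) ⟩
      0#                                              ∎

  totalSize : Elem → ℕ
  totalSize []      = 0
  totalSize (p ∷ z) = size (proj₂ p) + totalSize z

  pair-large : ∀ z T → totalSize z < size T → pair z T ≈ 0#
  pair-large z T z<T = ∑-zero z (λ p∈ → term p∈)
    where
    size≤total : ∀ {p} z → p ∈ z → size (proj₂ p) ≤ totalSize z
    size≤total (q ∷ z) (here refl) = m≤m+n _ _
    size≤total (q ∷ z) (there p∈)  = ≤-trans (size≤total z p∈) (m≤n+m _ _)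
    term : ∀ {p} → p ∈ z → (if proj₂ p ≼ T then proj₁ p else 0#) ≈ 0#
    term {p} p∈ with proj₂ p ≼ T in p≼T
    ... | false = ≈-refl
    ... | true  = contradiction (≤-trans (≤-reflexive (sym (≼⇒size≡ _ T p≼T))) (size≤total z p∈)) (<⇒≱ z<T)

  eqTree-stem : ∀ l l' → eqTree (stem l) (stem l') ≡ eqTree l' l
  eqTree-stem l l' with eqTree l' l in l'≡l
  ... | true  rewrite does-true⇒ (l' ≟ᵀ l) l'≡l = eqTree-refl (stem l)
  ... | false = dec-false (stem l ≟ᵀ stem l') (does-false⇒ (l' ≟ᵀ l) l'≡l ∘ sym ∘ stem-injective)

  stemExpansion : Elem → List (Carrier × Tree)
  stemExpansion x = map (λ l → pair x (stem l) , stem l) (treesOfHeight≤ (totalSize x))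

  stemExpansion-stems : ∀ x → All (IsStem ∘ proj₂) (stemExpansion x)
  stemExpansion-stems x = go (treesOfHeight≤ (totalSize x))
    where
    go : ∀ ls → All (IsStem ∘ proj₂) (map (λ l → pair x (stem l) , stem l) ls)
    go []       = []
    go (l ∷ ls) = (l , refl) ∷ go ls

  stemExpansion-pairings : ∀ x → VanishesOffStems x →
    ∀ T → ∑ (stemExpansion x) (λ q → proj₁ q ⊗ δ (proj₂ q) T) ≈ pair x T
  stemExpansion-pairings x offStems T =
    ≈-trans (≈-reflexive (cong sumL (sym (map-∘ L₀)))) (by-shape (decompose T))
    where
    N = totalSize x
    L₀ = treesOfHeight≤ N
    stem-term : ∀ l₀ → ∑ L₀ (λ l → pair x (stem l) ⊗ δ (stem l) (stem l₀)) ≈ pair x (stem l₀)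
    stem-term l₀ = begin
      ∑ L₀ (λ l → pair x (stem l) ⊗ δ (stem l) (stem l₀))
        ≈⟨ ∑-cong L₀ (λ {l} _ → ≈-trans (*-comm _ _) (*-congʳ (≈-reflexive (cong ι (eqTree-stem l l₀))))) ⟩
      ∑ L₀ (λ l → δ l₀ l ⊗ pair x (stem l))
        ≈⟨ ∑-pick _≟ᵀ_ l₀ (λ l → pair x (stem l)) L₀ ⟩
      fromℕ (count _≟ᵀ_ l₀ L₀) ⊗ pair x (stem l₀)
        ≈⟨ *-congʳ (≈-trans (≈-reflexive (cong fromℕ (count-treesOfHeight≤ N l₀))) (fromℕ-indicator _)) ⟩
      ι (height l₀ ≤ᵇ N) ⊗ pair x (stem l₀)
        ≈⟨ small ⟩
      pair x (stem l₀) ∎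
      where
      small : ι (height l₀ ≤ᵇ N) ⊗ pair x (stem l₀) ≈ pair x (stem l₀)
      small with height l₀ ≤ᵇ N in l₀≤N
      ... | true  = *-identityˡ _
      ... | false = ≈-trans (zeroˡ _) (≈-sym (pair-large x (stem l₀) (subst (N <_) (sym (size-stem l₀))
                      (m≤n⇒m≤1+n (<-≤-trans (≤ᵇ≡false⇒> {height l₀} {N} l₀≤N) (height≤size l₀))))))
    off-stem : (∀ l → stem l ≢ T) → ∑ L₀ (λ l → pair x (stem l) ⊗ δ (stem l) T) ≈ pair x T
    off-stem ¬stem = ≈-trans (∑-zero L₀ (λ {l} _ → ≈-trans (*-congˡ (δ-stem l T ¬stem)) (zeroʳ _)))
                             (≈-sym (offStems T ¬stem))
    by-shape : T ≡ leaf ⊎ IsStem T ⊎ (∃ λ A → ∃ λ B → 0 < size A × 0 < size B × T ≡ graft A B) →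
               ∑ L₀ (λ l → pair x (stem l) ⊗ δ (stem l) T) ≈ pair x T
    by-shape (inj₁ refl)                               = off-stem stem≢leaf
    by-shape (inj₂ (inj₁ (l₀ , refl)))                 = stem-term l₀
    by-shape (inj₂ (inj₂ (A , B , 0<A , 0<B , refl))) = off-stem (λ l → stem≢graft l A B 0<A 0<B)

  vanishesOffStems⇒span : ∀ V → IsDual V → ∀ x → VanishesOffStems x → InSpan IsStem V x
  vanishesOffStems⇒span V dual x offStems =
    stemExpansion x , stemExpansion-stems x , pairings⇒span V dual x (stemExpansion x) (stemExpansion-pairings x offStems)

  primitive⇔span : ∀ V → IsDual V → ∀ x → (Primitive x → InSpan IsStem V x) × (InSpan IsStem V x → Primitive x)
  primitive⇔span V dual x =
    vanishesOffStems⇒span V dual x ∘ primitive⇒vanishesOffStems x ,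
    vanishesOffStems⇒primitive x ∘ span⇒vanishesOffStems V dual x

-- The hypothesis that K is a field of characteristic 0 is not needed: no step divides.
mainTheorem17 : {c ℓ : Level} (K : CommutativeRing c ℓ) → OverRing.IsFieldChar0 K →
    ((V : Tree → OverRing.Elem K) → OverRing.IsDualToH K V →
      (x : OverRing.Elem K) →
      (OverRing.Primitive K x → OverRing.InSpan K RootNoRight V x) ×
      (OverRing.InSpan K RootNoRight V x → OverRing.Primitive K x))
  × ((W : Tree → OverRing.Elem K) → OverRing.IsDualToE K W →
      (x : OverRing.Elem K) →
      (OverRing.Primitive K x → OverRing.InSpan K RootNoLeft W x) ×
      (OverRing.InSpan K RootNoLeft W x → OverRing.Primitive K x))
mainTheorem17 K _ = Primitives.primitive⇔span H-order K , Primitives.primitive⇔span E-order K
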